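{- Let $G$ be a finite graph. For $\rho\in\mathcal O_{tc}(G)$ let $[\rho]$ be its Eulerian-equivalence class in $\mathcal O_{tc}(G)$, and let $[\mathcal O_{tc}(G)]$ be the set of these classes. Then $$\varphi_{\mathbb Z}(G,y)=\sum_{[\rho]\in[\mathcal O_{tc}(G)]}\#[\rho]\,\varphi_\rho(G,y),$$ summing over one representative per class. Furthermore, if $\#[\rho]=c$ for all $\rho\in\mathcal O_{tc}(G)$, then $\varphi_{\mathbb Z}(G,y)=c\,\varphi(G,y)$.
   Context: $G=(V,E)$ is a finite graph, loops and multiple edges allowed. An orientation chooses for each edge one of its two directions (loops also have two); $\mathcal O(G)$ is the set of orientations; $E(\rho\ne\sigma)$ is the set of edges where they differ. For an abelian group $A$, $g:E\to A$ is an $A$-flow of $(G,\varepsilon)$ if at each vertex the sum of $g$ over incoming edges equals the sum over outgoing edges; integer flows have $A=\mathbb Z$. A bond is a minimal nonempty edge set $[S,V\setminus S]$, directed if all its edges point the same way across; $\rho$ is totally cyclic if $(G,\rho)$ has no directed bond; $\mathcal O_{tc}(G)$ is the set of totally cyclic orientations. A directed Eulerian subgraph is an edge set with an orientation having equal in- and out-degree at every vertex. $\sigma$ is Eulerian-equivalent to $\rho$ if $E(\rho\ne\sigma)$, oriented by $\rho$, is a directed Eulerian subgraph (possibly empty). $\varphi_{\mathbb Z}(G,q)$ is the number of nowhere-zero integer flows $g$ of $(G,\varepsilon)$ (any fixed $\varepsilon$) with $|g(e)|<q$ for all $e$; $\varphi_\rho(G,q)$ is the number of integer flows $g$ of $(G,\rho)$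 with $0<g(e)<q$ for all $e$; $\varphi(G,q)$ is the number of nowhere-zero $A$-flows of $(G,\varepsilon)$ with $|A|=q$. All are polynomials in $q$. -}

module Defs where

open import Data.Nat as ℕ using (ℕ; zero; suc; _≤_; _<_)
open import Data.Integer as ℤ using (ℤ; +_; -[1+_]; _-_; ∣_∣)
open import Data.Integer.Divisibility.Signed using (_∣_; _∣?_)
import Data.Integer.Properties as ℤP
import Data.Nat.Properties as ℕP
open import Data.Fin using (Fin; toℕ)
import Data.Fin.Properties as FinP
open import Data.Fin.Subset using (Subset; inside; outside)
open import Data.Fin.Subset.Properties using (anySubset?)
open import Data.Bool using (Bool; true; false; if_then_else_; _xor_)
import Data.Bool.Properties as BoolP
open import Data.Vec as Vec using (Vec; []; _∷_; lookup)
open import Data.List as List using (List; []; _∷_; [_]; length; filter; concatMap; upTo)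
open import Data.List.Membership.Propositional using (_∈_)
open import Data.List.Relation.Unary.All using (All)
open import Data.List.Relation.Unary.Any using (Any)
open import Data.List.Relation.Unary.AllPairs using (AllPairs)
open import Data.Product using (Σ; ∃; _×_; _,_; proj₁; proj₂)
open import Relation.Nullary using (¬_; Dec; yes; no; ¬?)
open import Relation.Nullary.Decidable using (_×-dec_; decidable-stable)
open import Relation.Binary.PropositionalEquality using (_≡_; _≢_)

-- Finite graphs (loops and multiple edges allowed).
-- Vertices are Fin n, edges are Fin m; edge e has a reference
-- direction  proj₁ (ends e) → proj₂ (ends e)  (tail, head).

record Graph : Set where
  field
    n    : ℕ
    m    : ℕ
    ends : Fin m → Fin n × Fin n

open Graph public

-- An orientation chooses one of the two directions of every edge
-- (also for loops): true = reference direction, false = reversed.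
Orientation : Graph → Set
Orientation G = Vec Bool (m G)

ε : (G : Graph) → Orientation G
ε G = Vec.replicate (m G) true

tail : (G : Graph) → Orientation G → Fin (m G) → Fin (n G)
tail G ρ e = if lookup ρ e then proj₁ (ends G e) else proj₂ (ends G e)

head : (G : Graph) → Orientation G → Fin (m G) → Fin (n G)
head G ρ e = if lookup ρ e then proj₂ (ends G e) else proj₁ (ends G e)

Σᴱ : (G : Graph) → (Fin (m G) → ℤ) → ℤ
Σᴱ G f = Vec.foldr (λ _ → ℤ) ℤ._+_ (+ 0) (Vec.tabulate f)

Σᴱℕ : (G : Graph) → (Fin (m G) → ℕ) → ℕ
Σᴱℕ G f = Vec.foldr (λ _ → ℕ) ℕ._+_ 0 (Vec.tabulate f)

inSum : (G : Graph) → Orientation G → Vec ℤ (m G) → Fin (n G) → ℤ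
inSum G ρ g v =
  Σᴱ G (λ e → if Relation.Nullary.Decidable.⌊ head G ρ e Data.Fin.≟ v ⌋ then lookup g e else + 0)
  where import Relation.Nullary.Decidable
        import Data.Fin

outSum : (G : Graph) → Orientation G → Vec ℤ (m G) → Fin (n G) → ℤ
outSum G ρ g v =
  Σᴱ G (λ e → if Relation.Nullary.Decidable.⌊ tail G ρ e Data.Fin.≟ v ⌋ then lookup g e else + 0)
  where import Relation.Nullary.Decidable
        import Data.Fin

IsIntFlow : (G : Graph) → Orientation G → Vec ℤ (m G) → Set
IsIntFlow G ρ g = ∀ v → inSum G ρ g v ≡ outSum G ρ g v

-- Z_q-flows (A = ℤ/qℤ, elements represented by Fin q):
-- incoming sum ≡ outgoing sum modulo q
IsZqFlow : (G : Graph) (q : ℕ) → Orientation G → Vec (Fin q) (m G) → Set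
IsZqFlow G q ρ g = ∀ v → (+ q) ∣ (inSum G ρ g' v - outSum G ρ g' v)
  where g' = Vec.map (λ x → + toℕ x) g

vecs : ∀ {A : Set} → List A → (k : ℕ) → List (Vec A k)
vecs xs zero    = [ [] ]
vecs xs (suc k) = concatMap (λ x → List.map (x ∷_) (vecs xs k)) xs

count : ∀ {A : Set} {P : A → Set} → ((x : A) → Dec (P x)) → List A → ℕ
count P? xs = length (filter P? xs)

-- candidate integers: 0..q-1 and -1..-q  (the filters below impose |g(e)| < q)
intsBelow : ℕ → List ℤ
intsBelow q = List.map +_ (upTo q) List.++ List.map -[1+_] (upTo q)

allOrientations : (G : Graph) → List (Orientation G)
allOrientations G = vecs (true ∷ false ∷ []) (m G)

all-dec : ∀ {k} {P : Fin k → Set} → (∀ i → Dec (P i)) → Dec (∀ i → P i)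
all-dec = FinP.all?

ℤ-flow? : ∀ G ρ g → Dec (IsIntFlow G ρ g)
ℤ-flow? G ρ g = all-dec (λ v → inSum G ρ g v ℤP.≟ outSum G ρ g v)

Zq-flow? : ∀ G q ρ g → Dec (IsZqFlow G q ρ g)
Zq-flow? G q ρ g = all-dec (λ v → _ ∣? _)

NZIntFlowBelow : (G : Graph) → ℕ → Vec ℤ (m G) → Set
NZIntFlowBelow G q g =
  IsIntFlow G (ε G) g × (∀ e → lookup g e ≢ + 0) × (∀ e → ∣ lookup g e ∣ < q)

φℤ : Graph → ℕ → ℕ
φℤ G q = count {P = NZIntFlowBelow G q}
  (λ g → ℤ-flow? G (ε G) g
         ×-dec all-dec (λ e → ¬? (lookup g e ℤP.≟ + 0))
         ×-dec all-dec (λ e → ∣ lookup g e ∣ ℕP.<? q))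
  (vecs (intsBelow q) (m G))

PosIntFlowBelow : (G : Graph) → Orientation G → ℕ → Vec ℤ (m G) → Set
PosIntFlowBelow G ρ q g =
  IsIntFlow G ρ g × (∀ e → + 0 ℤ.< lookup g e) × (∀ e → lookup g e ℤ.< + q)

φ[_] : {G : Graph} → Orientation G → ℕ → ℕ
φ[_] {G} ρ q = count {P = PosIntFlowBelow G ρ q}
  (λ g → ℤ-flow? G ρ g
         ×-dec all-dec (λ e → + 0 ℤP.<? lookup g e)
         ×-dec all-dec (λ e → lookup g e ℤP.<? + q))
  (vecs (intsBelow q) (m G))

NZZqFlow : (G : Graph) (q : ℕ) → Vec (Fin q) (m G) → Set
NZZqFlow G q g = IsZqFlow G q (ε G) g × (∀ e → toℕ (lookup g e) ≢ 0)

φ : Graph → ℕ → ℕ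
φ G q = count {P = NZZqFlow G q}
  (λ g → Zq-flow? G q (ε G) g ×-dec all-dec (λ e → ¬? (toℕ (lookup g e) ℕP.≟ 0)))
  (vecs (List.allFin q) (m G))

InCut : (G : Graph) → Subset (n G) → Fin (m G) → Set
InCut G S e = lookup S (proj₁ (ends G e)) ≢ lookup S (proj₂ (ends G e))

-- [S, V∖S] is a bond: nonempty and minimal among nonempty cuts
IsBond : (G : Graph) → Subset (n G) → Set
IsBond G S =
  (∃ λ e → InCut G S e) ×
  (∀ T → (∃ λ e → InCut G T e) → (∀ e → InCut G T e → InCut G S e)
       → ∀ e → InCut G S e → InCut G T e)

DirectedOut : (G : Graph) → Orientation G → Subset (n G) → Set
DirectedOut G ρ S = ∀ e → InCut G S e →
  (lookup S (tail G ρ e) ≡ inside) × (lookup S (head G ρ e) ≡ outside)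

-- a directed bond: a bond [S,V∖S] all of whose edges point the same way
-- across (from S to V∖S, or from V∖S to S; the latter is the former for
-- the complement of S, but both are listed explicitly)
HasDirectedBond : (G : Graph) → Orientation G → Set
HasDirectedBond G ρ = ∃ λ S → IsBond G S ×
  (DirectedOut G ρ S ⊎′ (∀ e → InCut G S e →
     (lookup S (tail G ρ e) ≡ outside) × (lookup S (head G ρ e) ≡ inside)))
  where open import Data.Sum using () renaming (_⊎_ to _⊎′_)

TotallyCyclic : (G : Graph) → Orientation G → Set
TotallyCyclic G ρ = ¬ HasDirectedBond G ρ

Differ : (G : Graph) → Orientation G → Orientation G → Fin (m G) → Bool
Differ G ρ σ e = lookup ρ e xor lookup σ e

-- σ is Eulerian-equivalent to ρ: E(ρ≠σ), oriented by ρ, is a directed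
-- Eulerian subgraph (in-degree = out-degree at every vertex)
EulerEquiv : (G : Graph) → Orientation G → Orientation G → Set
EulerEquiv G σ ρ = ∀ v →
  Σᴱℕ G (λ e → if Differ G ρ σ e then (if ⌊ head G ρ e Data.Fin.≟ v ⌋ then 1 else 0) else 0)
  ≡ Σᴱℕ G (λ e → if Differ G ρ σ e then (if ⌊ tail G ρ e Data.Fin.≟ v ⌋ then 1 else 0) else 0)
  where open import Relation.Nullary.Decidable using (⌊_⌋)
        import Data.Fin

allSubset? : ∀ {k} {P : Subset k → Set} → (∀ S → Dec (P S)) → Dec (∀ S → P S)
allSubset? {P = P} P? with anySubset? (λ S → ¬? (P? S))
... | yes (S , ¬p) = no (λ h → ¬p (h S))
... | no ¬∃ = yes (λ S → decidable-stable (P? S) (λ ¬p → ¬∃ (S , ¬p)))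

InCut? : ∀ G S e → Dec (InCut G S e)
InCut? G S e = ¬? (lookup S (proj₁ (ends G e)) BoolP.≟ lookup S (proj₂ (ends G e)))

IsBond? : ∀ G S → Dec (IsBond G S)
IsBond? G S = FinP.any? (InCut? G S) ×-dec
  allSubset? (λ T → FinP.any? (InCut? G T) →-dec
    (all-dec (λ e → InCut? G T e →-dec InCut? G S e) →-dec
     all-dec (λ e → InCut? G S e →-dec InCut? G T e)))
  where open import Relation.Nullary.Decidable using (_→-dec_)

HasDirectedBond? : ∀ G ρ → Dec (HasDirectedBond G ρ)
HasDirectedBond? G ρ = anySubset? (λ S → IsBond? G S ×-dec
  (all-dec (λ e → InCut? G S e →-dec
     ((lookup S (tail G ρ e) BoolP.≟ inside) ×-dec (lookup S (head G ρ e) BoolP.≟ outside)))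
   ⊎-dec
   all-dec (λ e → InCut? G S e →-dec
     ((lookup S (tail G ρ e) BoolP.≟ outside) ×-dec (lookup S (head G ρ e) BoolP.≟ inside)))))
  where open import Relation.Nullary.Decidable using (_→-dec_; _⊎-dec_)

TotallyCyclic? : ∀ G ρ → Dec (TotallyCyclic G ρ)
TotallyCyclic? G ρ = ¬? (HasDirectedBond? G ρ)

EulerEquiv? : ∀ G σ ρ → Dec (EulerEquiv G σ ρ)
EulerEquiv? G σ ρ = all-dec (λ v → _ ℕP.≟ _)

classSize : (G : Graph) → Orientation G → ℕ
classSize G ρ = count {P = λ σ → TotallyCyclic G σ × EulerEquiv G σ ρ}
  (λ σ → TotallyCyclic? G σ ×-dec EulerEquiv? G σ ρ) (allOrientations G)

IsRepresentatives : (G : Graph) → List (Orientation G) → Set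
IsRepresentatives G R =
  All (TotallyCyclic G) R ×
  AllPairs (λ r r′ → ¬ EulerEquiv G r′ r) R ×
  (∀ σ → TotallyCyclic G σ → Any (EulerEquiv G σ) R)

sumOver : ∀ {A : Set} → List A → (A → ℕ) → ℕ
sumOver xs f = Data.Nat.ListAction.sum (List.map f xs)
  where import Data.Nat.ListAction

-- Splitting a nowhere-zero integer flow g into its sign pattern ρ and |g|
-- shows φℤ = Σ_ρ φ_ρ, and only totally cyclic ρ contribute: a positive flow
-- has zero net flow across every cut, so no bond is crossed in one direction
-- only. Reducing modulo q identifies the positive flows of (G, ρ) below q with
-- the nowhere-zero ℤ_q-flows f whose lift along ρ (f(e) on edges agreeing
-- with ε, q − f(e) on reversed ones) is an integer flow. Lifts along σ and ρ
-- differ by q times the Eulerian subgraph E(ρ≠σ), signed, so f lifts along ρ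
-- iff it lifts along every Eulerian-equivalent σ; hence φ_ρ is constant on
-- classes, which is the first formula. For the second, every nowhere-zero
-- ℤ_q-flow f lifts along some orientation: writing ∂f = q b, a 0/1 edge
-- weighting with boundary b exists by Hoffman's cut condition (induction on
-- the edges, with an uncrossing argument), and reversing its support works.
-- That orientation is totally cyclic, so f lifts along exactly one class, of
-- size c, and is counted c times.

module Submission where

open import Defs

module ListSums where

  open import Data.Nat using (ℕ; suc; _+_; _*_)
  open import Data.Nat.Properties using (+-assoc; +-identityʳ; *-comm; *-zeroʳ; *-distribˡ-+)
  open import Data.Nat.Tactic.RingSolver using (solve-∀)
  open import Data.Bool using (true; false; if_then_else_)
  open import Data.List as List using (List; []; _∷_; _++_; map; concatMap)
  open import Data.List.Relation.Unary.All as All using (All; []; _∷_)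
  open import Data.List.Relation.Unary.Any using (Any; here; there)
  open import Data.List.Relation.Unary.AllPairs using (AllPairs; []; _∷_)
  open import Data.Vec using (Vec; _∷_)
  open import Data.Product using (_×_; _,_)
  open import Data.Empty using (⊥; ⊥-elim)
  open import Relation.Nullary using (Dec; does; yes; no; ¬_)
  open import Relation.Nullary.Decidable using (_×-dec_)
  open import Relation.Binary.PropositionalEquality

  𝟙 : ∀ {p} {P : Set p} → Dec P → ℕ
  𝟙 d = if does d then 1 else 0

  𝟙-yes : ∀ {p} {P : Set p} (P? : Dec P) → P → 𝟙 P? ≡ 1
  𝟙-yes (yes _) _ = refl
  𝟙-yes (no ¬p) p = ⊥-elim (¬p p)

  𝟙-no : ∀ {p} {P : Set p} (P? : Dec P) → ¬ P → 𝟙 P? ≡ 0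
  𝟙-no (yes p) ¬p = ⊥-elim (¬p p)
  𝟙-no (no _)  _  = refl

  𝟙-cong : ∀ {p q} {P : Set p} {Q : Set q} (P? : Dec P) (Q? : Dec Q) →
           (P → Q) → (Q → P) → 𝟙 P? ≡ 𝟙 Q?
  𝟙-cong (yes p) Q? to from = sym (𝟙-yes Q? (to p))
  𝟙-cong (no ¬p) Q? to from = sym (𝟙-no Q? (λ q → ¬p (from q)))

  𝟙-× : ∀ {p q} {P : Set p} {Q : Set q} (P? : Dec P) (Q? : Dec Q) →
        𝟙 (P? ×-dec Q?) ≡ 𝟙 P? * 𝟙 Q?
  𝟙-× (yes _) (yes _) = refl
  𝟙-× (yes _) (no _)  = refl
  𝟙-× (no _)  _       = refl

  module _ {A : Set} where

    sumOver-++ : ∀ (xs ys : List A) f → sumOver (xs ++ ys) f ≡ sumOver xs f + sumOver ys f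
    sumOver-++ []       ys f = refl
    sumOver-++ (x ∷ xs) ys f = trans (cong (f x +_) (sumOver-++ xs ys f)) (sym (+-assoc (f x) _ _))

    sumOver-cong : ∀ (xs : List A) {f g : A → ℕ} → (∀ x → f x ≡ g x) → sumOver xs f ≡ sumOver xs g
    sumOver-cong []       f≗g = refl
    sumOver-cong (x ∷ xs) f≗g = cong₂ _+_ (f≗g x) (sumOver-cong xs f≗g)

    sumOver-zero : ∀ (xs : List A) {f : A → ℕ} → (∀ x → f x ≡ 0) → sumOver xs f ≡ 0
    sumOver-zero []       f≗0 = refl
    sumOver-zero (x ∷ xs) f≗0 = cong₂ _+_ (f≗0 x) (sumOver-zero xs f≗0)

    sumOver-distrib-+ : ∀ (xs : List A) f g → sumOver xs (λ x → f x + g x) ≡ sumOver xs f + sumOver xs g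
    sumOver-distrib-+ []       f g = refl
    sumOver-distrib-+ (x ∷ xs) f g = begin
      f x + g x + sumOver xs (λ x → f x + g x)   ≡⟨ cong (f x + g x +_) (sumOver-distrib-+ xs f g) ⟩
      f x + g x + (sumOver xs f + sumOver xs g)  ≡⟨ interchange (f x) (g x) _ _ ⟩
      f x + sumOver xs f + (g x + sumOver xs g)  ∎
      where
      open ≡-Reasoning
      interchange : ∀ a b c d → a + b + (c + d) ≡ a + c + (b + d)
      interchange = solve-∀

    *-distribˡ-sumOver : ∀ c (xs : List A) f → c * sumOver xs f ≡ sumOver xs (λ x → c * f x)
    *-distribˡ-sumOver c []       f = *-zeroʳ c
    *-distribˡ-sumOver c (x ∷ xs) f = trans (*-distribˡ-+ c (f x) _) (cong (c * f x +_) (*-distribˡ-sumOver c xs f))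

    *-distribʳ-sumOver : ∀ c (xs : List A) f → sumOver xs f * c ≡ sumOver xs (λ x → f x * c)
    *-distribʳ-sumOver c xs f = trans (*-comm (sumOver xs f) c)
      (trans (*-distribˡ-sumOver c xs f) (sumOver-cong xs (λ x → *-comm c (f x))))

    count≡sumOver𝟙 : ∀ {P : A → Set} (P? : ∀ x → Dec (P x)) xs → count P? xs ≡ sumOver xs (λ x → 𝟙 (P? x))
    count≡sumOver𝟙 P? []       = refl
    count≡sumOver𝟙 P? (x ∷ xs) with does (P? x)
    ... | true  = cong suc (count≡sumOver𝟙 P? xs)
    ... | false = count≡sumOver𝟙 P? xs

  sumOver-swap : ∀ {A B : Set} (xs : List A) (ys : List B) (f : A → B → ℕ) →
    sumOver xs (λ x → sumOver ys (f x)) ≡ sumOver ys (λ y → sumOver xs (λ x → f x y))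
  sumOver-swap []       ys f = sym (sumOver-zero ys (λ _ → refl))
  sumOver-swap (x ∷ xs) ys f = trans (cong (sumOver ys (f x) +_) (sumOver-swap xs ys f))
    (sym (sumOver-distrib-+ ys (f x) (λ y → sumOver xs (λ x′ → f x′ y))))

  sumOver-map : ∀ {A B : Set} (g : A → B) (xs : List A) f → sumOver (map g xs) f ≡ sumOver xs (λ x → f (g x))
  sumOver-map g []       f = refl
  sumOver-map g (x ∷ xs) f = cong (f (g x) +_) (sumOver-map g xs f)

  sumOver-concatMap : ∀ {A B : Set} (g : A → List B) (xs : List A) f →
    sumOver (concatMap g xs) f ≡ sumOver xs (λ x → sumOver (g x) f)
  sumOver-concatMap g []       f = refl
  sumOver-concatMap g (x ∷ xs) f = trans (sumOver-++ (g x) (concatMap g xs) f)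
    (cong (sumOver (g x) f +_) (sumOver-concatMap g xs f))

  sumOver-vecs-suc : ∀ {A : Set} (xs : List A) k (f : Vec A (suc k) → ℕ) →
    sumOver (vecs xs (suc k)) f ≡ sumOver xs (λ x → sumOver (vecs xs k) (λ v → f (x ∷ v)))
  sumOver-vecs-suc xs k f = trans (sumOver-concatMap _ xs f) (sumOver-cong xs (λ x → sumOver-map (x ∷_) (vecs xs k) f))

  module _ {A : Set} {Q : A → Set} (Q? : ∀ x → Dec (Q x)) (g : A → ℕ) where

    sumOver-𝟙-none : ∀ xs → All (λ x → ¬ Q x) xs → sumOver xs (λ x → 𝟙 (Q? x) * g x) ≡ 0
    sumOver-𝟙-none []       []         = refl
    sumOver-𝟙-none (x ∷ xs) (¬qx ∷ ¬qs) = cong₂ _+_ (cong (_* g x) (𝟙-no (Q? x) ¬qx)) (sumOver-𝟙-none xs ¬qs)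

    sumOver-𝟙-unique : ∀ xs → Any Q xs → AllPairs (λ x y → ¬ (Q x × Q y)) xs →
      ∀ {c} → (∀ x → Q x → g x ≡ c) → sumOver xs (λ x → 𝟙 (Q? x) * g x) ≡ c
    sumOver-𝟙-unique (x ∷ xs) (here qx) (apart ∷ _) {c} g≡c = begin
      𝟙 (Q? x) * g x + sumOver xs _   ≡⟨ cong₂ _+_ (cong (_* g x) (𝟙-yes (Q? x) qx)) (sumOver-𝟙-none xs (All.map (λ ¬qxy qy → ¬qxy (qx , qy)) apart)) ⟩
      g x + 0 + 0                     ≡⟨ trans (+-identityʳ _) (+-identityʳ _) ⟩
      g x                             ≡⟨ g≡c x qx ⟩
      c                               ∎
      where open ≡-Reasoning
    sumOver-𝟙-unique (x ∷ xs) (there q∈xs) (apart ∷ apart′) g≡c with Q? x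
    ... | yes qx = ⊥-elim (clash q∈xs apart)
      where
      clash : ∀ {ys} → Any Q ys → All (λ y → ¬ (Q x × Q y)) ys → ⊥
      clash (here qy)  (¬qxy ∷ _) = ¬qxy (qx , qy)
      clash (there qy) (_ ∷ ¬qs)  = clash qy ¬qs
    ... | no _ = sumOver-𝟙-unique xs q∈xs apart′ g≡c

module VectorSums where

  open ListSums
  open import Data.Nat using (ℕ; zero; suc; _*_)
  open import Data.Nat.Properties using (+-identityʳ; *-assoc)
  open import Data.List as List using (List)
  open import Data.Vec using (Vec; []; _∷_; zipWith)
  open import Relation.Binary.PropositionalEquality

  ∏ : ∀ {A : Set} {k} → (A → ℕ) → Vec A k → ℕ
  ∏ u []      = 1
  ∏ u (x ∷ v) = u x * ∏ u v

  sumOver-factor : ∀ {B : Set} c (vs : List B) (d f : B → ℕ) →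
    sumOver vs (λ v → c * d v * f v) ≡ c * sumOver vs (λ v → d v * f v)
  sumOver-factor c vs d f = trans (sumOver-cong vs (λ v → *-assoc c (d v) (f v))) (sym (*-distribˡ-sumOver c vs _))

  -- A one-coordinate change of variables (weights w on ys, u on xs) extends
  -- coordinatewise to vectors, the change of variables τ z varying with the coordinate.
  module _ {X Y Z : Set} (xs : List X) (ys : List Y) (u : X → ℕ) (w : Y → ℕ) (τ : Z → Y → X) where

    sumOver-vecs-reindex :
      (∀ z (F : X → ℕ) → sumOver ys (λ y → w y * F (τ z y)) ≡ sumOver xs (λ x → u x * F x)) →
      ∀ {k} (zv : Vec Z k) (P : Vec X k → ℕ) →
      sumOver (vecs ys k) (λ yv → ∏ w yv * P (zipWith τ zv yv)) ≡ sumOver (vecs xs k) (λ xv → ∏ u xv * P xv)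
    sumOver-vecs-reindex reindex []       P = refl
    sumOver-vecs-reindex reindex {suc k} (z ∷ zv) P = begin
        sumOver (vecs ys (suc k)) (λ yv → ∏ w yv * P (zipWith τ (z ∷ zv) yv))
      ≡⟨ sumOver-vecs-suc ys k _ ⟩
        sumOver ys (λ y → sumOver (vecs ys k) (λ yv → w y * ∏ w yv * P (τ z y ∷ zipWith τ zv yv)))
      ≡⟨ sumOver-cong ys (λ y → sumOver-factor (w y) (vecs ys k) (∏ w) _) ⟩
        sumOver ys (λ y → w y * sumOver (vecs ys k) (λ yv → ∏ w yv * P (τ z y ∷ zipWith τ zv yv)))
      ≡⟨ sumOver-cong ys (λ y → cong (w y *_) (sumOver-vecs-reindex reindex zv (λ xv → P (τ z y ∷ xv)))) ⟩
        sumOver ys (λ y → w y * F (τ z y))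
      ≡⟨ reindex z F ⟩
        sumOver xs (λ x → u x * F x)
      ≡⟨ sumOver-cong xs (λ x → sym (sumOver-factor (u x) (vecs xs k) (∏ u) _)) ⟩
        sumOver xs (λ x → sumOver (vecs xs k) (λ xv → u x * ∏ u xv * P (x ∷ xv)))
      ≡⟨ sym (sumOver-vecs-suc xs k _) ⟩
        sumOver (vecs xs (suc k)) (λ xv → ∏ u xv * P xv)
      ∎
      where
      open ≡-Reasoning
      F : X → ℕ
      F x = sumOver (vecs xs k) (λ xv → ∏ u xv * P (x ∷ xv))

    sumOver-vecs-split :
      ∀ (zs : List Z) → (∀ (F : X → ℕ) → sumOver xs (λ x → u x * F x) ≡ sumOver zs (λ z → sumOver ys (λ y → w y * F (τ z y)))) →
      ∀ k (P : Vec X k → ℕ) →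
      sumOver (vecs xs k) (λ xv → ∏ u xv * P xv) ≡
      sumOver (vecs zs k) (λ zv → sumOver (vecs ys k) (λ yv → ∏ w yv * P (zipWith τ zv yv)))
    sumOver-vecs-split zs split zero    P = sym (+-identityʳ _)
    sumOver-vecs-split zs split (suc k) P = begin
        sumOver (vecs xs (suc k)) (λ xv → ∏ u xv * P xv)
      ≡⟨ sumOver-vecs-suc xs k _ ⟩
        sumOver xs (λ x → sumOver (vecs xs k) (λ xv → u x * ∏ u xv * P (x ∷ xv)))
      ≡⟨ sumOver-cong xs (λ x → sumOver-factor (u x) (vecs xs k) (∏ u) _) ⟩
        sumOver xs (λ x → u x * sumOver (vecs xs k) (λ xv → ∏ u xv * P (x ∷ xv)))
      ≡⟨ sumOver-cong xs (λ x → cong (u x *_) (sumOver-vecs-split zs split k (λ xv → P (x ∷ xv)))) ⟩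
        sumOver xs (λ x → u x * F x)
      ≡⟨ split F ⟩
        sumOver zs (λ z → sumOver ys (λ y → w y * F (τ z y)))
      ≡⟨ sumOver-cong zs (λ z → sumOver-cong ys (λ y → interchange z y)) ⟩
        sumOver zs (λ z → sumOver ys (λ y → sumOver (vecs zs k) (λ zv → G z y zv)))
      ≡⟨ sumOver-cong zs (λ z → sumOver-swap ys (vecs zs k) (G z)) ⟩
        sumOver zs (λ z → sumOver (vecs zs k) (λ zv → sumOver ys (λ y → G z y zv)))
      ≡⟨ sumOver-cong zs (λ z → sumOver-cong (vecs zs k) (λ zv → sym (sumOver-vecs-suc ys k _))) ⟩
        sumOver zs (λ z → sumOver (vecs zs k) (λ zv → sumOver (vecs ys (suc k)) (λ yv → ∏ w yv * P (zipWith τ (z ∷ zv) yv))))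
      ≡⟨ sym (sumOver-vecs-suc zs k _) ⟩
        sumOver (vecs zs (suc k)) (λ zv → sumOver (vecs ys (suc k)) (λ yv → ∏ w yv * P (zipWith τ zv yv)))
      ∎
      where
      open ≡-Reasoning
      F : X → ℕ
      F x = sumOver (vecs zs k) (λ zv → sumOver (vecs ys k) (λ yv → ∏ w yv * P (x ∷ zipWith τ zv yv)))
      G : Z → Y → Vec Z k → ℕ
      G z y zv = sumOver (vecs ys k) (λ yv → w y * ∏ w yv * P (τ z y ∷ zipWith τ zv yv))
      interchange : ∀ z y → w y * F (τ z y) ≡ sumOver (vecs zs k) (G z y)
      interchange z y = trans (*-distribˡ-sumOver (w y) (vecs zs k) _)
        (sumOver-cong (vecs zs k) (λ zv → sym (sumOver-factor (w y) (vecs ys k) (∏ w) _)))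

module Boundary where

  open import Data.Nat as ℕ using (ℕ; zero; suc)
  open import Data.Integer using (ℤ; +_; _+_; _-_; _*_; -_; _≤_; _<_)
  open import Data.Integer.Properties
  open import Data.Integer.Tactic.RingSolver using (solve-∀)
  open import Algebra.Properties.Semiring.Sum +-*-semiring
    using (sum; sum-syntax; sum-cong-≗; ∑-distrib-+; ∑-comm; *-distribˡ-sum; sum-replicate-zero)
  open import Data.Fin as Fin using (Fin; zero; suc)
  open import Data.Bool using (Bool; true; false)
  open import Data.Vec as Vec using (tabulate)
  open import Data.Product using (∃; _×_; _,_; proj₁; proj₂)
  open import Relation.Nullary using (Dec; ¬_; yes; no)
  open import Relation.Nullary.Decidable using (⌊_⌋)
  open import Relation.Binary.PropositionalEquality
  open import Function using (_∘_)

  χ : Bool → ℤ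
  χ true  = + 1
  χ false = + 0

  δ : ∀ {n} → Fin n → Fin n → ℤ
  δ a v = χ ⌊ a Fin.≟ v ⌋

  ∑-distrib-- : ∀ {k} (f g : Fin k → ℤ) → ∑[ e < k ] (f e - g e) ≡ sum f - sum g
  ∑-distrib-- {k} f g = begin
    ∑[ e < k ] (f e - g e)                ≡⟨ ∑-distrib-+ f (λ e → - g e) ⟩
    sum f + ∑[ e < k ] (- g e)            ≡⟨ cong (_+_ (sum f)) (sum-cong-≗ (λ e → neg≡-1* (g e))) ⟩
    sum f + ∑[ e < k ] (- + 1 * g e)      ≡⟨ cong (_+_ (sum f)) (sym (*-distribˡ-sum (- + 1) g)) ⟩
    sum f + - + 1 * sum g                 ≡⟨ cong (_+_ (sum f)) (sym (neg≡-1* (sum g))) ⟩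
    sum f - sum g                         ∎
    where
    open ≡-Reasoning
    neg≡-1* : ∀ a → - a ≡ - + 1 * a
    neg≡-1* = solve-∀

  ∑-mono-≤ : ∀ {k} {f g : Fin k → ℤ} → (∀ e → f e ≤ g e) → sum f ≤ sum g
  ∑-mono-≤ {zero}  f≤g = ≤-refl
  ∑-mono-≤ {suc k} f≤g = +-mono-≤ (f≤g zero) (∑-mono-≤ (f≤g ∘ suc))

  ∑-mono-< : ∀ {k} {f g : Fin k → ℤ} → (∀ e → f e ≤ g e) → ∀ e₀ → f e₀ < g e₀ → sum f < sum g
  ∑-mono-< f≤g zero    lt = +-mono-<-≤ lt (∑-mono-≤ (f≤g ∘ suc))
  ∑-mono-< f≤g (suc e) lt = +-mono-≤-< (f≤g zero) (∑-mono-< (f≤g ∘ suc) e lt)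

  ∑-strict : ∀ {k} {f g : Fin k → ℤ} {C : Fin k → Set} → (∀ e → Dec (C e)) →
    (∀ e → ¬ C e → f e ≡ g e) → (∀ e → C e → f e < g e) → ∃ C → sum f < sum g
  ∑-strict C? f≡g f<g (e₀ , Ce₀) = ∑-mono-< f≤g e₀ (f<g e₀ Ce₀)
    where
    f≤g : ∀ e → _ ≤ _
    f≤g e with C? e
    ... | yes Ce = <⇒≤ (f<g e Ce)
    ... | no ¬Ce = ≤-reflexive (f≡g e ¬Ce)

  ∑-δ : ∀ {n} (c : Fin n → ℤ) (a : Fin n) → ∑[ v < n ] (c v * δ a v) ≡ c a
  ∑-δ {suc n} c zero = begin
    c zero * + 1 + sum (λ v → c (suc v) * + 0)  ≡⟨ cong₂ _+_ (*-identityʳ (c zero)) (sum-cong-≗ (*-zeroʳ ∘ c ∘ suc)) ⟩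
    c zero + sum {n} (λ _ → + 0)                ≡⟨ cong (_+_ (c zero)) (sum-replicate-zero n) ⟩
    c zero + + 0                                ≡⟨ +-identityʳ (c zero) ⟩
    c zero                                      ∎
    where open ≡-Reasoning
  ∑-δ {suc n} c (suc a) = begin
    c zero * + 0 + sum (λ v → c (suc v) * δ (suc a) (suc v))  ≡⟨ cong₂ _+_ (*-zeroʳ (c zero)) (sum-cong-≗ (λ v → cong (c (suc v) *_) (δ-suc v))) ⟩
    + 0 + sum (λ v → c (suc v) * δ a v)                       ≡⟨ +-identityˡ _ ⟩
    sum (λ v → c (suc v) * δ a v)                             ≡⟨ ∑-δ (c ∘ suc) a ⟩
    c (suc a)                                                 ∎
    where
    open ≡-Reasoning
    δ-suc : ∀ v → δ (suc a) (suc v) ≡ δ a v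
    δ-suc v with a Fin.≟ v
    ... | yes _ = refl
    ... | no _  = refl

  Σᴱ≡∑ : ∀ G (f : Fin (m G) → ℤ) → Σᴱ G f ≡ sum f
  Σᴱ≡∑ G f = foldr-tabulate f
    where
    foldr-tabulate : ∀ {k} (f : Fin k → ℤ) → Vec.foldr (λ _ → ℤ) _+_ (+ 0) (tabulate f) ≡ sum f
    foldr-tabulate {zero}  f = refl
    foldr-tabulate {suc k} f = cong (_+_ (f zero)) (foldr-tabulate (f ∘ suc))

  +Σᴱℕ≡∑ : ∀ G (f : Fin (m G) → ℕ) → + Σᴱℕ G f ≡ ∑[ e < m G ] (+ f e)
  +Σᴱℕ≡∑ G f = foldr-tabulate f
    where
    foldr-tabulate : ∀ {k} (f : Fin k → ℕ) → + Vec.foldr (λ _ → ℕ) ℕ._+_ 0 (tabulate f) ≡ ∑[ e < k ] (+ f e)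
    foldr-tabulate {zero}  f = refl
    foldr-tabulate {suc k} f = trans (pos-+ (f zero) _) (cong (_+_ (+ f zero)) (foldr-tabulate (f ∘ suc)))

  module _ {n k} (E : Fin k → Fin n × Fin n) where

    incidence : Fin k → Fin n → ℤ
    incidence e v = δ (proj₂ (E e)) v - δ (proj₁ (E e)) v

    ∂ : (Fin k → ℤ) → Fin n → ℤ
    ∂ x v = ∑[ e < k ] (x e * incidence e v)

    ∂-cong : ∀ {x y : Fin k → ℤ} → (∀ e → x e ≡ y e) → ∀ v → ∂ x v ≡ ∂ y v
    ∂-cong x≗y v = sum-cong-≗ (λ e → cong (_* incidence e v) (x≗y e))

    ∂-distrib-- : ∀ (x y : Fin k → ℤ) v → ∂ (λ e → x e - y e) v ≡ ∂ x v - ∂ y v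
    ∂-distrib-- x y v = trans (sum-cong-≗ (λ e → *-distribʳ-- (x e) (y e) (incidence e v)))
                                (∑-distrib-- (λ e → x e * incidence e v) (λ e → y e * incidence e v))
      where
      *-distribʳ-- : ∀ a b c → (a - b) * c ≡ a * c - b * c
      *-distribʳ-- = solve-∀

    ∂-* : ∀ c (x : Fin k → ℤ) v → ∂ (λ e → c * x e) v ≡ c * ∂ x v
    ∂-* c x v = trans (sum-cong-≗ (λ e → *-assoc c (x e) (incidence e v)))
                      (sym (*-distribˡ-sum c (λ e → x e * incidence e v)))

    ∑-χ-incidence : ∀ (s : Fin n → Bool) e →
      ∑[ v < n ] (χ (s v) * incidence e v) ≡ χ (s (proj₂ (E e))) - χ (s (proj₁ (E e)))
    ∑-χ-incidence s e = begin
      ∑[ v < n ] (χ (s v) * incidence e v)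
        ≡⟨ sum-cong-≗ (λ v → *-distribˡ-- (χ (s v)) _ _) ⟩
      ∑[ v < n ] (χ (s v) * δ (proj₂ (E e)) v - χ (s v) * δ (proj₁ (E e)) v)
        ≡⟨ ∑-distrib-- (λ v → χ (s v) * δ (proj₂ (E e)) v) (λ v → χ (s v) * δ (proj₁ (E e)) v) ⟩
      ∑[ v < n ] (χ (s v) * δ (proj₂ (E e)) v) - ∑[ v < n ] (χ (s v) * δ (proj₁ (E e)) v)
        ≡⟨ cong₂ _-_ (∑-δ (χ ∘ s) (proj₂ (E e))) (∑-δ (χ ∘ s) (proj₁ (E e))) ⟩
      χ (s (proj₂ (E e))) - χ (s (proj₁ (E e)))
        ∎
      where
      open ≡-Reasoning
      *-distribˡ-- : ∀ a b c → a * (b - c) ≡ a * b - a * c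
      *-distribˡ-- = solve-∀

    ∑-χ-∂ : ∀ (s : Fin n → Bool) x →
      ∑[ v < n ] (χ (s v) * ∂ x v) ≡ ∑[ e < k ] (x e * (χ (s (proj₂ (E e))) - χ (s (proj₁ (E e)))))
    ∑-χ-∂ s x = begin
        ∑[ v < n ] (χ (s v) * ∂ x v)
      ≡⟨ sum-cong-≗ (λ v → *-distribˡ-sum (χ (s v)) (λ e → x e * incidence e v)) ⟩
        ∑[ v < n ] ∑[ e < k ] (χ (s v) * (x e * incidence e v))
      ≡⟨ ∑-comm (λ v e → χ (s v) * (x e * incidence e v)) ⟩
        ∑[ e < k ] ∑[ v < n ] (χ (s v) * (x e * incidence e v))
      ≡⟨ sum-cong-≗ (λ e → trans (sum-cong-≗ (λ v → exchange (χ (s v)) (x e) (incidence e v)))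
                                  (sym (*-distribˡ-sum (x e) (λ v → χ (s v) * incidence e v)))) ⟩
        ∑[ e < k ] (x e * ∑[ v < n ] (χ (s v) * incidence e v))
      ≡⟨ sum-cong-≗ (λ e → cong (x e *_) (∑-χ-incidence s e)) ⟩
        ∑[ e < k ] (x e * (χ (s (proj₂ (E e))) - χ (s (proj₁ (E e)))))
      ∎
      where
      open ≡-Reasoning
      exchange : ∀ a b c → a * (b * c) ≡ b * (a * c)
      exchange = solve-∀

    ∑-∂ : ∀ x → ∑[ v < n ] (∂ x v) ≡ + 0
    ∑-∂ x = begin
      ∑[ v < n ] (∂ x v)                ≡⟨ sum-cong-≗ (λ v → sym (*-identityˡ (∂ x v))) ⟩
      ∑[ v < n ] (χ true * ∂ x v)       ≡⟨ ∑-χ-∂ (λ _ → true) x ⟩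
      ∑[ e < k ] (x e * (+ 1 - + 1))    ≡⟨ sum-cong-≗ (λ e → *-zeroʳ (x e)) ⟩
      ∑[ e < k ] (+ 0)                  ≡⟨ sum-replicate-zero k ⟩
      + 0                               ∎
      where open ≡-Reasoning

    ∑-incidence : ∀ e → ∑[ v < n ] (incidence e v) ≡ + 0
    ∑-incidence e = trans (sum-cong-≗ (λ v → sym (*-identityˡ (incidence e v)))) (∑-χ-incidence (λ _ → true) e)

module ZeroOneBoundary where

  open Boundary
  open import Data.Nat as ℕ using (ℕ; zero; suc)
  open import Data.Integer using (ℤ; +_; _+_; _-_; _*_; -_; _≤_; _<_; +<+)
  open import Data.Integer.Properties
  open import Data.Integer.Tactic.RingSolver using (solve-∀)
  open import Algebra.Properties.Semiring.Sum +-*-semiring using (sum; sum-syntax; sum-cong-≗; ∑-distrib-+; *-distribˡ-sum)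
  open import Data.Fin as Fin using (Fin; zero; suc)
  open import Data.Fin.Subset.Properties using (anySubset?)
  open import Data.Bool using (Bool; true; false; _∧_; _∨_; not)
  open import Data.Vec using (lookup; tabulate)
  open import Data.Vec.Properties using (lookup∘tabulate)
  open import Data.Vec.Functional using (_∷_)
  open import Data.Product using (Σ-syntax; ∃; _×_; _,_; proj₁; proj₂)
  open import Data.Sum using (_⊎_; inj₁; inj₂)
  open import Data.Empty using (⊥; ⊥-elim)
  open import Relation.Nullary using (yes; no)
  open import Relation.Nullary.Decidable using (⌊_⌋; True; toWitness)
  open import Relation.Binary.PropositionalEquality
  open import Function using (_∘_)

  decided : ∀ {x y : ℤ} {x≤y : True (x ≤? y)} → x ≤ y
  decided {x≤y = x≤y} = toWitness x≤y

  squeeze : ∀ {x y c d : ℤ} → y ≤ c + x → x < y - d → d < c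
  squeeze {x} {y} {c} {d} y≤c+x x<y-d = subst₂ _<_ (cancel d x) (cancel c x) (+-monoˡ-< (- x) d+x<c+x)
    where
    plus-minus : ∀ d y → d + (y - d) ≡ y
    plus-minus = solve-∀
    cancel : ∀ a x → a + x - x ≡ a
    cancel = solve-∀
    d+x<c+x : d + x < c + x
    d+x<c+x = <-≤-trans (subst (d + x <_) (plus-minus d y) (+-monoʳ-< d x<y-d)) y≤c+x

  <+1⇒≤ : ∀ {i j : ℤ} → i < j + + 1 → i ≤ j
  <+1⇒≤ {i} {j} i<j+1 = subst₂ _≤_ (pred-one-plus i) (pred-plus-one j) (pred-mono (i<j⇒suc[i]≤j i<j+1))
    where
    pred-one-plus : ∀ i → - + 1 + (+ 1 + i) ≡ i
    pred-one-plus = solve-∀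
    pred-plus-one : ∀ j → - + 1 + (j + + 1) ≡ j
    pred-plus-one = solve-∀

  module _ {n : ℕ} where

    mass : (Fin n → Bool) → (Fin n → ℤ) → ℤ
    mass s b = ∑[ v < n ] (χ (s v) * b v)

    mass-cong : ∀ {s t : Fin n → Bool} b → (∀ v → s v ≡ t v) → mass s b ≡ mass t b
    mass-cong b s≗t = sum-cong-≗ (λ v → cong (λ z → χ z * b v) (s≗t v))

    mass-singleton : ∀ b (v : Fin n) → mass (λ u → ⌊ v Fin.≟ u ⌋) b ≡ b v
    mass-singleton b v = trans (sum-cong-≗ (λ u → *-comm (δ v u) (b u))) (∑-δ b v)

    mass-complement : ∀ s b → mass (not ∘ s) b ≡ sum b - mass s b
    mass-complement s b = trans (sum-cong-≗ (λ v → pointwise (s v) (b v))) (∑-distrib-- b (λ v → χ (s v) * b v))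
      where
      pointwise : ∀ a x → χ (not a) * x ≡ x - χ a * x
      pointwise true  x = in-s x
        where
        in-s : ∀ x → + 0 * x ≡ x - + 1 * x
        in-s = solve-∀
      pointwise false x = out-of-s x
        where
        out-of-s : ∀ x → + 1 * x ≡ x - + 0 * x
        out-of-s = solve-∀

    mass-modular : ∀ s t b → mass (λ v → s v ∧ t v) b + mass (λ v → s v ∨ t v) b ≡ mass s b + mass t b
    mass-modular s t b = begin
      mass (λ v → s v ∧ t v) b + mass (λ v → s v ∨ t v) b    ≡⟨ sym (∑-distrib-+ (λ v → χ (s v ∧ t v) * b v) _) ⟩
      ∑[ v < n ] (χ (s v ∧ t v) * b v + χ (s v ∨ t v) * b v) ≡⟨ sum-cong-≗ (λ v → pointwise (s v) (t v) (b v)) ⟩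
      ∑[ v < n ] (χ (s v) * b v + χ (t v) * b v)             ≡⟨ ∑-distrib-+ (λ v → χ (s v) * b v) _ ⟩
      mass s b + mass t b                                     ∎
      where
      open ≡-Reasoning
      pointwise : ∀ a c x → χ (a ∧ c) * x + χ (a ∨ c) * x ≡ χ a * x + χ c * x
      pointwise true  true  x = refl
      pointwise true  false x = +-comm (+ 0 * x) (+ 1 * x)
      pointwise false c     x = refl

  module _ {n k : ℕ} (E : Fin k → Fin n × Fin n) where

    entering-edge : (Fin n → Bool) → Fin k → ℤ
    entering-edge s e = χ (s (proj₂ (E e)) ∧ not (s (proj₁ (E e))))

    entering : (Fin n → Bool) → ℤ
    entering s = sum (entering-edge s)

    entering-cong : ∀ {s t} → (∀ v → s v ≡ t v) → entering s ≡ entering t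
    entering-cong s≗t = sum-cong-≗ (λ e → cong₂ (λ a c → χ (a ∧ not c)) (s≗t (proj₂ (E e))) (s≗t (proj₁ (E e))))

    entering-submodular : ∀ s t →
      entering (λ v → s v ∧ t v) + entering (λ v → s v ∨ t v) ≤ entering s + entering t
    entering-submodular s t = subst₂ _≤_ (∑-distrib-+ (entering-edge (λ v → s v ∧ t v)) (entering-edge (λ v → s v ∨ t v)))
                                        (∑-distrib-+ (entering-edge s) (entering-edge t))
      (∑-mono-≤ (λ e → pointwise (s (proj₂ (E e))) (t (proj₂ (E e))) (s (proj₁ (E e))) (t (proj₁ (E e)))))
      where
      pointwise : ∀ a b c d → χ ((a ∧ b) ∧ not (c ∧ d)) + χ ((a ∨ b) ∧ not (c ∨ d)) ≤ χ (a ∧ not c) + χ (b ∧ not d)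
      pointwise false false c     d     = ≤-refl
      pointwise true  true  false false = decided
      pointwise true  true  false true  = decided
      pointwise true  true  true  false = decided
      pointwise true  true  true  true  = decided
      pointwise true  false false false = decided
      pointwise true  false false true  = decided
      pointwise true  false true  false = decided
      pointwise true  false true  true  = decided
      pointwise false true  false false = decided
      pointwise false true  false true  = decided
      pointwise false true  true  false = decided
      pointwise false true  true  true  = decided

    -- Hoffman's condition for b to be the boundary of a 0/1 edge weighting.
    CutCondition : (Fin n → ℤ) → Set
    CutCondition b = ∀ s → mass s b ≤ entering s

    Violated : (Fin n → ℤ) → (Fin n → Bool) → Set
    Violated b s = entering s < mass s b

    violated-or-cutCondition : ∀ b → (∃ λ s → Violated b s) ⊎ CutCondition b
    violated-or-cutCondition b with anySubset? (λ S → entering (lookup S) <? mass (lookup S) b)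
    ... | yes (S , violated) = inj₁ (lookup S , violated)
    ... | no ¬violated = inj₂ λ s → subst₂ _≤_ (mass-cong b (lookup∘tabulate s)) (entering-cong (lookup∘tabulate s))
                                       (≮⇒≥ (λ violated → ¬violated (tabulate s , violated)))

  cutCondition-no-edges : ∀ {n} (E : Fin 0 → Fin n × Fin n) b → sum b ≡ + 0 → CutCondition E b → ∀ v → b v ≡ + 0
  cutCondition-no-edges E b ∑b≡0 cut v = ≤-antisym (subst (_≤ + 0) (mass-singleton b v) (cut singleton)) 0≤bv
    where
    singleton : Fin _ → Bool
    singleton u = ⌊ v Fin.≟ u ⌋
    0≤bv : + 0 ≤ b v
    0≤bv = neg-cancel-≤ (subst (_≤ + 0)
      (trans (mass-complement singleton b) (trans (cong₂ _-_ ∑b≡0 (mass-singleton b v)) (+-identityˡ (- b v))))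
      (cut (not ∘ singleton)))

  χ-entering-positive : ∀ a c → + 0 < χ (a ∧ not c) → a ≡ true × c ≡ false
  χ-entering-positive true  false _ = refl , refl
  χ-entering-positive true  true  (+<+ ())
  χ-entering-positive false c     (+<+ ())

  χ-crossing<χ-entering : ∀ a c → χ a - χ c < χ (a ∧ not c) → a ≡ false × c ≡ true
  χ-crossing<χ-entering false true  _ = refl , refl
  χ-crossing<χ-entering true  true  (+<+ ())
  χ-crossing<χ-entering true  false (+<+ (ℕ.s≤s ()))
  χ-crossing<χ-entering false false (+<+ ())

  minusIncidence₀ : ∀ {n k} → (Fin (suc k) → Fin n × Fin n) → (Fin n → ℤ) → Fin n → ℤ
  minusIncidence₀ E b v = b v - incidence E zero v

  -- Uncrossing: a set violating the condition for b on the remaining edges must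
  -- contain the head but not the tail of edge zero, one violating it for
  -- b − ∂(edge zero) the other way round; their intersection and union then
  -- contradict submodularity.
  module _ {n k : ℕ} (E : Fin (suc k) → Fin n × Fin n) (b : Fin n → ℤ) (cut : CutCondition E b) where

    private
      E′ = E ∘ suc
      w = proj₂ (E zero)
      u = proj₁ (E zero)
      b′ = minusIncidence₀ E b

    violated⇒edge₀-enters : ∀ s → Violated E′ b s → s w ≡ true × s u ≡ false
    violated⇒edge₀-enters s violated =
      χ-entering-positive (s w) (s u) (squeeze (cut s) (subst (entering E′ s <_) (sym (+-identityʳ (mass s b))) violated))

    mass-minus-incidence : ∀ s → mass s b′ ≡ mass s b - (χ (s w) - χ (s u))
    mass-minus-incidence s = begin
      ∑[ v < n ] (χ (s v) * (b v - incidence E zero v))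
        ≡⟨ sum-cong-≗ (λ v → *-distribˡ-- (χ (s v)) (b v) _) ⟩
      ∑[ v < n ] (χ (s v) * b v - χ (s v) * incidence E zero v)
        ≡⟨ ∑-distrib-- (λ v → χ (s v) * b v) (λ v → χ (s v) * incidence E zero v) ⟩
      mass s b - ∑[ v < n ] (χ (s v) * incidence E zero v)
        ≡⟨ cong (_-_ (mass s b)) (∑-χ-incidence E s zero) ⟩
      mass s b - (χ (s w) - χ (s u))
        ∎
      where
      open ≡-Reasoning
      *-distribˡ-- : ∀ a x y → a * (x - y) ≡ a * x - a * y
      *-distribˡ-- = solve-∀

    violated′⇒edge₀-leaves : ∀ s → Violated E′ b′ s → (s w ≡ false × s u ≡ true) × entering E′ s ≤ mass s b
    violated′⇒edge₀-leaves s violated = edge-position , <+1⇒≤ (subst (entering E′ s <_) mass-b′ violated)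
      where
      edge-position : s w ≡ false × s u ≡ true
      edge-position = χ-crossing<χ-entering (s w) (s u)
        (squeeze (cut s) (subst (entering E′ s <_) (mass-minus-incidence s) violated))
      mass-b′ : mass s b′ ≡ mass s b + + 1
      mass-b′ = trans (mass-minus-incidence s) (cong₂ (λ a c → mass s b - (χ a - χ c)) (proj₁ edge-position) (proj₂ edge-position))

    no-two-violations : ∀ s t → Violated E′ b s → Violated E′ b′ t → ⊥
    no-two-violations s t violated-s violated-t = <-irrefl refl (begin-strict
        mass s b + mass t b
      ≡⟨ sym (mass-modular s t b) ⟩
        mass (λ v → s v ∧ t v) b + mass (λ v → s v ∨ t v) b
      ≤⟨ +-mono-≤ (cut (λ v → s v ∧ t v)) (cut (λ v → s v ∨ t v)) ⟩
        entering E (λ v → s v ∧ t v) + entering E (λ v → s v ∨ t v)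
      ≡⟨ cong₂ _+_ (edge-zero-not-entering (λ v → s v ∧ t v) ∩-not-entered)
                     (edge-zero-not-entering (λ v → s v ∨ t v) ∪-not-entered) ⟩
        entering E′ (λ v → s v ∧ t v) + entering E′ (λ v → s v ∨ t v)
      ≤⟨ entering-submodular E′ s t ⟩
        entering E′ s + entering E′ t
      <⟨ +-mono-<-≤ violated-s (proj₂ (violated′⇒edge₀-leaves t violated-t)) ⟩
        mass s b + mass t b
      ∎)
      where
      open ≤-Reasoning
      s-ends = violated⇒edge₀-enters s violated-s
      t-ends = proj₁ (violated′⇒edge₀-leaves t violated-t)
      edge-zero-not-entering : ∀ r → (r w ∧ not (r u)) ≡ false → entering E r ≡ entering E′ r
      edge-zero-not-entering r eq = trans (cong (λ z → χ z + entering E′ r) eq) (+-identityˡ _)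
      ∩-not-entered : ((s w ∧ t w) ∧ not (s u ∧ t u)) ≡ false
      ∩-not-entered = cong (λ a → a ∧ not (s u ∧ t u)) (cong₂ _∧_ (proj₁ s-ends) (proj₁ t-ends))
      ∪-not-entered : ((s w ∨ t w) ∧ not (s u ∨ t u)) ≡ false
      ∪-not-entered = cong₂ (λ a c → a ∧ not c) (cong₂ _∨_ (proj₁ s-ends) (proj₁ t-ends)) (cong₂ _∨_ (proj₂ s-ends) (proj₂ t-ends))

  ∂-false∷ : ∀ {n k} (E : Fin (suc k) → Fin n × Fin n) (x : Fin k → Bool) v →
    ∂ E (χ ∘ (false ∷ x)) v ≡ ∂ (E ∘ suc) (χ ∘ x) v
  ∂-false∷ E x v = trans (cong (_+ ∂ (E ∘ suc) (χ ∘ x) v) (*-zeroˡ (incidence E zero v))) (+-identityˡ _)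

  ∂-true∷ : ∀ {n k} (E : Fin (suc k) → Fin n × Fin n) b (x : Fin k → Bool) →
    (∀ v → ∂ (E ∘ suc) (χ ∘ x) v ≡ minusIncidence₀ E b v) → ∀ v → ∂ E (χ ∘ (true ∷ x)) v ≡ b v
  ∂-true∷ E b x ∂x≡b′ v = begin
    + 1 * incidence E zero v + ∂ (E ∘ suc) (χ ∘ x) v   ≡⟨ cong₂ _+_ (*-identityˡ (incidence E zero v)) (∂x≡b′ v) ⟩
    incidence E zero v + (b v - incidence E zero v)    ≡⟨ plus-minus (incidence E zero v) (b v) ⟩
    b v                                                ∎
    where
    open ≡-Reasoning
    plus-minus : ∀ d x → d + (x - d) ≡ x
    plus-minus = solve-∀

  ∑-minusIncidence₀ : ∀ {n k} (E : Fin (suc k) → Fin n × Fin n) b → sum b ≡ + 0 → sum (minusIncidence₀ E b) ≡ + 0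
  ∑-minusIncidence₀ E b ∑b≡0 = trans (∑-distrib-- b (incidence E zero)) (cong₂ _-_ ∑b≡0 (∑-incidence E zero))

  cutCondition⇒zeroOneSolution : ∀ {n k} (E : Fin k → Fin n × Fin n) (b : Fin n → ℤ) →
    sum b ≡ + 0 → CutCondition E b → Σ[ x ∈ (Fin k → Bool) ] (∀ v → ∂ E (χ ∘ x) v ≡ b v)
  cutCondition⇒zeroOneSolution {k = zero} E b ∑b≡0 cut = (λ ()) , λ v → sym (cutCondition-no-edges E b ∑b≡0 cut v)
  cutCondition⇒zeroOneSolution {n} {suc k} E b ∑b≡0 cut
    with violated-or-cutCondition (E ∘ suc) b | violated-or-cutCondition (E ∘ suc) (minusIncidence₀ E b)
  ... | inj₂ cut′ | _ with cutCondition⇒zeroOneSolution (E ∘ suc) b ∑b≡0 cut′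
  ...   | x , ∂x≡b = (false ∷ x) , λ v → trans (∂-false∷ E x v) (∂x≡b v)
  cutCondition⇒zeroOneSolution {n} {suc k} E b ∑b≡0 cut
      | inj₁ (s , violated-s) | inj₁ (t , violated-t) = ⊥-elim (no-two-violations E b cut s t violated-s violated-t)
  cutCondition⇒zeroOneSolution {n} {suc k} E b ∑b≡0 cut
      | inj₁ _ | inj₂ cut′ with cutCondition⇒zeroOneSolution (E ∘ suc) (minusIncidence₀ E b) (∑-minusIncidence₀ E b ∑b≡0) cut′
  ...   | x , ∂x≡b′ = (true ∷ x) , ∂-true∷ E b x ∂x≡b′

  -- If ∂ x = q b with 0 ≤ x ≤ q, then summing over s gives q·mass s b ≤ q·entering s.
  scaledBoundary⇒zeroOneSolution : ∀ {n k} (E : Fin k → Fin n × Fin n) (p : ℕ) (x : Fin k → ℤ) (b : Fin n → ℤ) →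
    (∀ e → + 0 ≤ x e) → (∀ e → x e ≤ + suc p) → (∀ v → ∂ E x v ≡ b v * + suc p) →
    Σ[ y ∈ (Fin k → Bool) ] (∀ v → ∂ E (χ ∘ y) v ≡ b v)
  scaledBoundary⇒zeroOneSolution {n} {k} E p x b 0≤x x≤q ∂x≡bq = cutCondition⇒zeroOneSolution E b ∑b≡0 cut
    where
    open ≡-Reasoning
    q = + suc p
    ∑b≡0 : sum b ≡ + 0
    ∑b≡0 = *-cancelˡ-≡ q (sum b) (+ 0) (begin
      q * sum b                   ≡⟨ *-distribˡ-sum q b ⟩
      ∑[ v < n ] (q * b v)        ≡⟨ sum-cong-≗ (λ v → trans (*-comm q (b v)) (sym (∂x≡bq v))) ⟩
      ∑[ v < n ] (∂ E x v)        ≡⟨ ∑-∂ E x ⟩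
      + 0                         ≡⟨ sym (*-zeroʳ q) ⟩
      q * + 0                     ∎)
    q*mass : ∀ s → q * mass s b ≡ ∑[ e < k ] (x e * (χ (s (proj₂ (E e))) - χ (s (proj₁ (E e)))))
    q*mass s = begin
      q * mass s b                        ≡⟨ *-distribˡ-sum q (λ v → χ (s v) * b v) ⟩
      ∑[ v < n ] (q * (χ (s v) * b v))    ≡⟨ sum-cong-≗ (λ v → trans (exchange q (χ (s v)) (b v)) (cong (χ (s v) *_) (sym (∂x≡bq v)))) ⟩
      ∑[ v < n ] (χ (s v) * ∂ E x v)      ≡⟨ ∑-χ-∂ E s x ⟩
      _                                   ∎
      where exchange : ∀ q a y → q * (a * y) ≡ a * (y * q)
            exchange = solve-∀
    bounded-crossing : ∀ y a c → + 0 ≤ y → y ≤ q → y * (χ a - χ c) ≤ q * χ (a ∧ not c)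
    bounded-crossing y true  true  _   _   = ≤-reflexive (trans (*-zeroʳ y) (sym (*-zeroʳ q)))
    bounded-crossing y false false _   _   = ≤-reflexive (trans (*-zeroʳ y) (sym (*-zeroʳ q)))
    bounded-crossing y true  false _   y≤q = subst₂ _≤_ (sym (*-identityʳ y)) (sym (*-identityʳ q)) y≤q
    bounded-crossing y false true  0≤y _   = subst₂ _≤_ (sym (times-minus-one y)) (sym (*-zeroʳ q)) (neg-mono-≤ 0≤y)
      where times-minus-one : ∀ y → y * (+ 0 - + 1) ≡ - y
            times-minus-one = solve-∀
    cut : CutCondition E b
    cut s = *-cancelʳ-≤-pos (mass s b) (entering E s) q (subst₂ _≤_
      (trans (sym (q*mass s)) (*-comm q (mass s b)))
      (trans (sym (*-distribˡ-sum q (entering-edge E s))) (*-comm q (entering E s)))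
      (∑-mono-≤ (λ e → bounded-crossing (x e) (s (proj₂ (E e))) (s (proj₁ (E e))) (0≤x e) (x≤q e))))

module IntegerFlows where

  open Boundary
  open import Data.Nat as ℕ using (ℕ)
  open import Data.Integer using (ℤ; +_; _+_; _-_; _*_; -_; _<_)
  open import Data.Integer.Properties
  open import Data.Integer.Tactic.RingSolver using (solve-∀)
  open import Algebra.Properties.Semiring.Sum +-*-semiring using (sum; sum-syntax; sum-cong-≗; sum-replicate-zero)
  open import Data.Fin as Fin using (Fin)
  open import Data.Fin.Subset using (Subset)
  open import Data.Bool using (true; false; if_then_else_; _xor_)
  import Data.Bool.Properties as BoolP
  open import Data.Vec as Vec using (Vec; lookup)
  open import Data.Product using (_,_; proj₁; proj₂)
  open import Data.Sum using (inj₁; inj₂)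
  open import Relation.Nullary using (¬_)
  open import Relation.Nullary.Decidable using (⌊_⌋; decidable-stable)
  open import Relation.Binary.PropositionalEquality

  module _ (G : Graph) where

    Circulation : (Fin (m G) → ℤ) → Set
    Circulation x = ∀ v → ∂ (ends G) x v ≡ + 0

    circulation-− : ∀ {x y} → Circulation x → Circulation y → Circulation (λ e → x e - y e)
    circulation-− {x} {y} ∂x≡0 ∂y≡0 v = trans (∂-distrib-- (ends G) x y v) (cong₂ _-_ (∂x≡0 v) (∂y≡0 v))

    signed : Orientation G → Vec ℤ (m G) → Fin (m G) → ℤ
    signed ρ g e = if lookup ρ e then lookup g e else - lookup g e

    inSum-outSum≡∂ : ∀ ρ g v → inSum G ρ g v - outSum G ρ g v ≡ ∂ (ends G) (signed ρ g) v
    inSum-outSum≡∂ ρ g v = begin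
        inSum G ρ g v - outSum G ρ g v
      ≡⟨ cong₂ _-_ (trans (Σᴱ≡∑ G _) (sum-cong-≗ (λ e → if≡*δ _ (lookup g e))))
                   (trans (Σᴱ≡∑ G _) (sum-cong-≗ (λ e → if≡*δ _ (lookup g e)))) ⟩
        ∑[ e < m G ] (lookup g e * δ (head G ρ e) v) - ∑[ e < m G ] (lookup g e * δ (tail G ρ e) v)
      ≡⟨ sym (∑-distrib-- (λ e → lookup g e * δ (head G ρ e) v) (λ e → lookup g e * δ (tail G ρ e) v)) ⟩
        ∑[ e < m G ] (lookup g e * δ (head G ρ e) v - lookup g e * δ (tail G ρ e) v)
      ≡⟨ sum-cong-≗ (λ e → oriented (lookup ρ e) (lookup g e) (proj₂ (ends G e)) (proj₁ (ends G e))) ⟩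
        ∂ (ends G) (signed ρ g) v
      ∎
      where
      open ≡-Reasoning
      if≡*δ : ∀ d x → (if d then x else + 0) ≡ x * χ d
      if≡*δ true  x = sym (*-identityʳ x)
      if≡*δ false x = sym (*-zeroʳ x)
      oriented : ∀ o x h t → x * δ (if o then h else t) v - x * δ (if o then t else h) v
                           ≡ (if o then x else - x) * (δ h v - δ t v)
      oriented true  x h t = distrib x (δ h v) (δ t v)
        where distrib : ∀ x a b → x * a - x * b ≡ x * (a - b)
              distrib = solve-∀
      oriented false x h t = distrib x (δ h v) (δ t v)
        where distrib : ∀ x a b → x * b - x * a ≡ - x * (a - b)
              distrib = solve-∀

    isIntFlow⇒circulation : ∀ {ρ g} → IsIntFlow G ρ g → Circulation (signed ρ g)
    isIntFlow⇒circulation {ρ} {g} flow v = trans (sym (inSum-outSum≡∂ ρ g v)) (i≡j⇒i-j≡0 (flow v))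

    circulation⇒isIntFlow : ∀ {ρ g} → Circulation (signed ρ g) → IsIntFlow G ρ g
    circulation⇒isIntFlow {ρ} {g} circ v = i-j≡0⇒i≡j _ _ (trans (inSum-outSum≡∂ ρ g v) (circ v))

    forward : Orientation G → Fin (m G) → ℤ
    forward ρ e = χ (lookup ρ e)

    eulerImbalance≡∂ : ∀ σ ρ v →
        + Σᴱℕ G (λ e → if Differ G ρ σ e then (if ⌊ head G ρ e Fin.≟ v ⌋ then 1 else 0) else 0)
      - + Σᴱℕ G (λ e → if Differ G ρ σ e then (if ⌊ tail G ρ e Fin.≟ v ⌋ then 1 else 0) else 0)
      ≡ ∂ (ends G) (λ e → forward ρ e - forward σ e) v
    eulerImbalance≡∂ σ ρ v = trans (cong₂ _-_ (+Σᴱℕ≡∑ G into) (+Σᴱℕ≡∑ G outOf))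
      (trans (sym (∑-distrib-- (λ e → + into e) (λ e → + outOf e)))
             (sum-cong-≗ (λ e → pointwise (lookup ρ e) (lookup σ e) (proj₂ (ends G e)) (proj₁ (ends G e)))))
      where
      into outOf : Fin (m G) → ℕ
      into e = if Differ G ρ σ e then (if ⌊ head G ρ e Fin.≟ v ⌋ then 1 else 0) else 0
      outOf e = if Differ G ρ σ e then (if ⌊ tail G ρ e Fin.≟ v ⌋ then 1 else 0) else 0
      +if≡χ : ∀ d → + (if d then 1 else 0) ≡ χ d
      +if≡χ true  = refl
      +if≡χ false = refl
      pointwise : ∀ r s h t →
          + (if r xor s then (if ⌊ (if r then h else t) Fin.≟ v ⌋ then 1 else 0) else 0)
        - + (if r xor s then (if ⌊ (if r then t else h) Fin.≟ v ⌋ then 1 else 0) else 0)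
        ≡ (χ r - χ s) * (δ h v - δ t v)
      pointwise true  true  h t = sym (*-zeroˡ (δ h v - δ t v))
      pointwise false false h t = sym (*-zeroˡ (δ h v - δ t v))
      pointwise true  false h t = trans (cong₂ _-_ (+if≡χ ⌊ h Fin.≟ v ⌋) (+if≡χ ⌊ t Fin.≟ v ⌋)) (sym (*-identityˡ _))
      pointwise false true  h t = trans (cong₂ _-_ (+if≡χ ⌊ t Fin.≟ v ⌋) (+if≡χ ⌊ h Fin.≟ v ⌋)) (reverse (δ h v) (δ t v))
        where reverse : ∀ a b → b - a ≡ (+ 0 - + 1) * (a - b)
              reverse = solve-∀

    eulerEquiv⇒circulation : ∀ {σ ρ} → EulerEquiv G σ ρ → Circulation (λ e → forward ρ e - forward σ e)
    eulerEquiv⇒circulation {σ} {ρ} equiv v = trans (sym (eulerImbalance≡∂ σ ρ v)) (i≡j⇒i-j≡0 (cong +_ (equiv v)))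

    circulation⇒eulerEquiv : ∀ {σ ρ} → Circulation (λ e → forward ρ e - forward σ e) → EulerEquiv G σ ρ
    circulation⇒eulerEquiv {σ} {ρ} circ v = +-injective (i-j≡0⇒i≡j _ _ (trans (eulerImbalance≡∂ σ ρ v) (circ v)))

    eulerEquiv-euclidean : ∀ {ρ r r′} → EulerEquiv G ρ r → EulerEquiv G ρ r′ → EulerEquiv G r′ r
    eulerEquiv-euclidean {ρ} {r} {r′} ρ~r ρ~r′ = circulation⇒eulerEquiv {r′} {r} λ v →
      trans (∂-cong (ends G) (λ e → difference (forward r e) (forward r′ e) (forward ρ e)) v)
            (circulation-− {λ e → forward r e - forward ρ e} {λ e → forward r′ e - forward ρ e}
                           (eulerEquiv⇒circulation {ρ} {r} ρ~r) (eulerEquiv⇒circulation {ρ} {r′} ρ~r′) v)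
      where difference : ∀ a b c → a - b ≡ (a - c) - (b - c)
            difference = solve-∀

    crossing : Orientation G → Vec ℤ (m G) → Subset (n G) → Fin (m G) → ℤ
    crossing ρ h S e = lookup h e * (χ (lookup S (head G ρ e)) - χ (lookup S (tail G ρ e)))

    ∑crossing≡0 : ∀ {ρ h} → IsIntFlow G ρ h → ∀ S → sum (crossing ρ h S) ≡ + 0
    ∑crossing≡0 {ρ} {h} flow S = begin
        sum (crossing ρ h S)
      ≡⟨ sum-cong-≗ (λ e → oriented (lookup ρ e) (lookup h e) (proj₂ (ends G e)) (proj₁ (ends G e))) ⟩
        ∑[ e < m G ] (signed ρ h e * (χ (s (proj₂ (ends G e))) - χ (s (proj₁ (ends G e)))))
      ≡⟨ sym (∑-χ-∂ (ends G) s (signed ρ h)) ⟩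
        ∑[ v < n G ] (χ (s v) * ∂ (ends G) (signed ρ h) v)
      ≡⟨ sum-cong-≗ (λ v → trans (cong (χ (s v) *_) (isIntFlow⇒circulation {ρ} {h} flow v)) (*-zeroʳ (χ (s v)))) ⟩
        ∑[ v < n G ] (+ 0)
      ≡⟨ sum-replicate-zero (n G) ⟩
        + 0
      ∎
      where
      open ≡-Reasoning
      s = lookup S
      oriented : ∀ o x h t → x * (χ (s (if o then h else t)) - χ (s (if o then t else h)))
                           ≡ (if o then x else - x) * (χ (s h) - χ (s t))
      oriented true  x h t = refl
      oriented false x h t = flip x (χ (s h)) (χ (s t))
        where flip : ∀ x a b → x * (b - a) ≡ - x * (a - b)
              flip = solve-∀

    crossing-outside-cut : ∀ ρ h S e → ¬ InCut G S e → crossing ρ h S e ≡ + 0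
    crossing-outside-cut ρ h S e e∉cut = begin
        lookup h e * (χ (lookup S (head G ρ e)) - χ (lookup S (tail G ρ e)))
      ≡⟨ cong (λ z → lookup h e * (χ z - χ (lookup S (tail G ρ e)))) (same-side (lookup ρ e)) ⟩
        lookup h e * (χ (lookup S (tail G ρ e)) - χ (lookup S (tail G ρ e)))
      ≡⟨ cong (lookup h e *_) (+-inverseʳ (χ (lookup S (tail G ρ e)))) ⟩
        lookup h e * + 0
      ≡⟨ *-zeroʳ (lookup h e) ⟩
        + 0
      ∎
      where
      open ≡-Reasoning
      ends-same-side : lookup S (proj₁ (ends G e)) ≡ lookup S (proj₂ (ends G e))
      ends-same-side = decidable-stable (lookup S (proj₁ (ends G e)) BoolP.≟ lookup S (proj₂ (ends G e))) e∉cut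
      same-side : ∀ o → lookup S (if o then proj₂ (ends G e) else proj₁ (ends G e))
                      ≡ lookup S (if o then proj₁ (ends G e) else proj₂ (ends G e))
      same-side true  = sym ends-same-side
      same-side false = ends-same-side

    positiveFlow⇒totallyCyclic : ∀ {ρ h} → IsIntFlow G ρ h → (∀ e → + 0 < lookup h e) → TotallyCyclic G ρ
    positiveFlow⇒totallyCyclic {ρ} {h} flow positive (S , (nonempty , _) , inj₁ outward) =
      <-irrefl (∑crossing≡0 {ρ} {h} flow S) (subst (sum (crossing ρ h S) <_) (sum-replicate-zero (m G))
        (∑-strict {g = λ _ → + 0} (InCut? G S) (crossing-outside-cut ρ h S) crossing<0 nonempty))
      where
      crossing<0 : ∀ e → InCut G S e → crossing ρ h S e < + 0
      crossing<0 e e∈cut = subst (_< + 0)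
        (sym (trans (cong₂ (λ t hd → lookup h e * (χ hd - χ t)) (proj₁ (outward e e∈cut)) (proj₂ (outward e e∈cut)))
                    (times-minus-one (lookup h e))))
        (neg-mono-< (positive e))
        where times-minus-one : ∀ x → x * (+ 0 - + 1) ≡ - x
              times-minus-one = solve-∀
    positiveFlow⇒totallyCyclic {ρ} {h} flow positive (S , (nonempty , _) , inj₂ inward) =
      <-irrefl (sym (∑crossing≡0 {ρ} {h} flow S)) (subst (_< sum (crossing ρ h S)) (sum-replicate-zero (m G))
        (∑-strict {f = λ _ → + 0} (InCut? G S) (λ e e∉cut → sym (crossing-outside-cut ρ h S e e∉cut)) 0<crossing nonempty))
      where
      0<crossing : ∀ e → InCut G S e → + 0 < crossing ρ h S e
      0<crossing e e∈cut = subst (+ 0 <_)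
        (sym (trans (cong₂ (λ t hd → lookup h e * (χ hd - χ t)) (proj₁ (inward e e∈cut)) (proj₂ (inward e e∈cut)))
                    (times-one (lookup h e))))
        (positive e)
        where times-one : ∀ x → x * (+ 1 - + 0) ≡ x
              times-one = solve-∀

module Lifts where

  open Boundary
  open ZeroOneBoundary
  open IntegerFlows
  open import Data.Nat as ℕ using (ℕ; zero; suc)
  import Data.Nat.Properties as ℕP
  open import Data.Integer using (ℤ; +_; _+_; _-_; _*_; -_; _<_; +<+; +≤+)
  open import Data.Integer.Properties
  open import Data.Integer.Divisibility.Signed using (divides; _∣_; quotient)
  open import Data.Integer.Tactic.RingSolver using (solve-∀)
  open import Data.Fin as Fin using (Fin; toℕ)
  open import Data.Fin.Properties using (toℕ<n)
  open import Data.Bool using (Bool; true; false; not; if_then_else_)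
  open import Data.Vec as Vec using (Vec; lookup; tabulate; zipWith)
  open import Data.Vec.Properties using (lookup∘tabulate; lookup-zipWith; lookup-map; lookup-replicate)
  open import Data.Product using (Σ-syntax; _,_; proj₁; proj₂)
  open import Data.Empty using (⊥-elim)
  open import Relation.Binary.PropositionalEquality
  open import Function using (_∘_)

  -- Read along a reversed edge, f(e) ∈ ℤ_q becomes −f(e) ≡ q − f(e); liftEntry
  -- takes the representative in [0, q] of the value read along the orientation.
  liftEntry : ∀ {q} → Bool → Fin q → ℤ
  liftEntry     true  y = + toℕ y
  liftEntry {q} false y = + q - + toℕ y

  module _ (G : Graph) (p : ℕ) where

    private
      q = suc p

    lift : Orientation G → Vec (Fin q) (m G) → Vec ℤ (m G)
    lift ρ f = zipWith liftEntry ρ f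

    residue : Vec (Fin q) (m G) → Fin (m G) → ℤ
    residue f e = + toℕ (lookup f e)

    backward : Orientation G → Fin (m G) → ℤ
    backward ρ e = + 1 - forward G ρ e

    ∂-lift : ∀ ρ f v → ∂ (ends G) (signed G ρ (lift ρ f)) v ≡ ∂ (ends G) (residue f) v - + q * ∂ (ends G) (backward ρ) v
    ∂-lift ρ f v = begin
      ∂ (ends G) (signed G ρ (lift ρ f)) v                                  ≡⟨ ∂-cong (ends G) signed-lift v ⟩
      ∂ (ends G) (λ e → residue f e - + q * backward ρ e) v                ≡⟨ ∂-distrib-- (ends G) (residue f) (λ e → + q * backward ρ e) v ⟩
      ∂ (ends G) (residue f) v - ∂ (ends G) (λ e → + q * backward ρ e) v   ≡⟨ cong (_-_ (∂ (ends G) (residue f) v)) (∂-* (ends G) (+ q) (backward ρ) v) ⟩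
      ∂ (ends G) (residue f) v - + q * ∂ (ends G) (backward ρ) v           ∎
      where
      open ≡-Reasoning
      pointwise : ∀ o y → (if o then liftEntry o y else - liftEntry o y) ≡ + toℕ y - + q * (+ 1 - χ o)
      pointwise true  y = kept (+ toℕ y) (+ q)
        where kept : ∀ y q → y ≡ y - q * (+ 1 - + 1)
              kept = solve-∀
      pointwise false y = complemented (+ toℕ y) (+ q)
        where complemented : ∀ y q → - (q - y) ≡ y - q * (+ 1 - + 0)
              complemented = solve-∀
      signed-lift : ∀ e → signed G ρ (lift ρ f) e ≡ residue f e - + q * backward ρ e
      signed-lift e rewrite lookup-zipWith liftEntry e ρ f = pointwise (lookup ρ e) (lookup f e)

    ∂-residue : ∀ f v → inSum G (ε G) (Vec.map (λ x → + toℕ x) f) v - outSum G (ε G) (Vec.map (λ x → + toℕ x) f) v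
                      ≡ ∂ (ends G) (residue f) v
    ∂-residue f v = trans (inSum-outSum≡∂ G (ε G) (Vec.map (λ x → + toℕ x) f) v) (∂-cong (ends G) reference v)
      where
      reference : ∀ e → signed G (ε G) (Vec.map (λ x → + toℕ x) f) e ≡ residue f e
      reference e rewrite lookup-replicate e true | lookup-map e (λ x → + toℕ x) f = refl

    liftCirculation⇒isZqFlow : ∀ {ρ f} → Circulation G (signed G ρ (lift ρ f)) → IsZqFlow G q (ε G) f
    liftCirculation⇒isZqFlow {ρ} {f} circ v = divides (∂ (ends G) (backward ρ) v)
      (trans (∂-residue f v) (trans (i-j≡0⇒i≡j _ _ (trans (sym (∂-lift ρ f v)) (circ v))) (*-comm (+ q) _)))

    liftCirculations⇒eulerEquiv : ∀ {ρ r f} → Circulation G (signed G ρ (lift ρ f)) → Circulation G (signed G r (lift r f)) →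
      EulerEquiv G ρ r
    liftCirculations⇒eulerEquiv {ρ} {r} {f} circ-ρ circ-r = circulation⇒eulerEquiv G {ρ} {r} λ v → begin
        ∂ (ends G) (λ e → forward G r e - forward G ρ e) v
      ≡⟨ ∂-cong (ends G) (λ e → difference (forward G r e) (forward G ρ e)) v ⟩
        ∂ (ends G) (λ e → backward ρ e - backward r e) v
      ≡⟨ ∂-distrib-- (ends G) (backward ρ) (backward r) v ⟩
        ∂ (ends G) (backward ρ) v - ∂ (ends G) (backward r) v
      ≡⟨ i≡j⇒i-j≡0 (*-cancelˡ-≡ (+ q) _ _ (trans (sym (q∂backward ρ circ-ρ v)) (q∂backward r circ-r v))) ⟩
        + 0
      ∎
      where
      open ≡-Reasoning
      difference : ∀ a b → a - b ≡ (+ 1 - b) - (+ 1 - a)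
      difference = solve-∀
      q∂backward : ∀ σ → Circulation G (signed G σ (lift σ f)) → ∀ v → ∂ (ends G) (residue f) v ≡ + q * ∂ (ends G) (backward σ) v
      q∂backward σ circ v = i-j≡0⇒i≡j _ _ (trans (sym (∂-lift σ f v)) (circ v))

    ∂-lift-eulerEquiv : ∀ {σ ρ} f → EulerEquiv G σ ρ → ∀ v →
      ∂ (ends G) (signed G σ (lift σ f)) v ≡ ∂ (ends G) (signed G ρ (lift ρ f)) v
    ∂-lift-eulerEquiv {σ} {ρ} f σ~ρ v = begin
        ∂ (ends G) (signed G σ (lift σ f)) v
      ≡⟨ ∂-lift σ f v ⟩
        ∂ (ends G) (residue f) v - + q * ∂ (ends G) (backward σ) v
      ≡⟨ cong (λ z → ∂ (ends G) (residue f) v - + q * z) backward-σ≡backward-ρ ⟩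
        ∂ (ends G) (residue f) v - + q * ∂ (ends G) (backward ρ) v
      ≡⟨ sym (∂-lift ρ f v) ⟩
        ∂ (ends G) (signed G ρ (lift ρ f)) v
      ∎
      where
      open ≡-Reasoning
      difference : ∀ a b → + 1 - a ≡ (+ 1 - b) - (a - b)
      difference = solve-∀
      backward-σ≡backward-ρ : ∂ (ends G) (backward σ) v ≡ ∂ (ends G) (backward ρ) v
      backward-σ≡backward-ρ = sym (begin
        ∂ (ends G) (backward ρ) v                                              ≡⟨ ∂-cong (ends G) (λ e → difference (forward G ρ e) (forward G σ e)) v ⟩
        ∂ (ends G) (λ e → backward σ e - (forward G ρ e - forward G σ e)) v   ≡⟨ ∂-distrib-- (ends G) (backward σ) _ v ⟩
        ∂ (ends G) (backward σ) v - ∂ (ends G) (λ e → forward G ρ e - forward G σ e) v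
                                                                               ≡⟨ cong (_-_ (∂ (ends G) (backward σ) v)) (eulerEquiv⇒circulation G {σ} {ρ} σ~ρ v) ⟩
        ∂ (ends G) (backward σ) v - + 0                                        ≡⟨ +-identityʳ _ ⟩
        ∂ (ends G) (backward σ) v                                              ∎)

    complement-ℕ : ∀ (y : Fin q) → + q - + toℕ y ≡ + (q ℕ.∸ toℕ y)
    complement-ℕ y = trans (m-n≡m⊖n q (toℕ y)) (⊖-≥ (ℕP.<⇒≤ (toℕ<n y)))

    module _ {f : Vec (Fin q) (m G)} (nonzero : ∀ e → toℕ (lookup f e) ≢ 0) where

      lift-positive : ∀ ρ e → + 0 < lookup (lift ρ f) e
      lift-positive ρ e rewrite lookup-zipWith liftEntry e ρ f = positive (lookup ρ e) (lookup f e) (nonzero e)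
        where
        positive : ∀ o y → toℕ y ≢ 0 → + 0 < liftEntry o y
        positive true  y y≢0 with toℕ y
        ... | zero  = ⊥-elim (y≢0 refl)
        ... | suc _ = +<+ (ℕ.s≤s ℕ.z≤n)
        positive false y _ = subst (+ 0 <_) (sym (complement-ℕ y)) (+<+ (ℕP.m<n⇒0<n∸m (toℕ<n y)))

    -- Writing ∂ f = q b, a 0/1 weighting with boundary b marks the edges to reverse.
    isZqFlow⇒liftCirculation : ∀ {f} → IsZqFlow G q (ε G) f → Σ[ ρ ∈ Orientation G ] Circulation G (signed G ρ (lift ρ f))
    isZqFlow⇒liftCirculation {f} zq = ρ , circulation
      where
      open ≡-Reasoning
      b : Fin (n G) → ℤ
      b v = quotient (zq v)
      ∂residue≡bq : ∀ v → ∂ (ends G) (residue f) v ≡ b v * + q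
      ∂residue≡bq v = trans (sym (∂-residue f v)) (_∣_.equality (zq v))
      solution = scaledBoundary⇒zeroOneSolution (ends G) p (residue f) b
        (λ e → +≤+ ℕ.z≤n) (λ e → +≤+ (ℕP.<⇒≤ (toℕ<n (lookup f e)))) ∂residue≡bq
      x = proj₁ solution
      ρ : Orientation G
      ρ = tabulate (not ∘ x)
      backward≡χx : ∀ e → backward ρ e ≡ χ (x e)
      backward≡χx e = trans (cong (λ z → + 1 - χ z) (lookup∘tabulate (not ∘ x) e)) (complement (x e))
        where complement : ∀ a → + 1 - χ (not a) ≡ χ a
              complement true  = refl
              complement false = refl
      circulation : Circulation G (signed G ρ (lift ρ f))
      circulation v = begin
        ∂ (ends G) (signed G ρ (lift ρ f)) v                        ≡⟨ ∂-lift ρ f v ⟩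
        ∂ (ends G) (residue f) v - + q * ∂ (ends G) (backward ρ) v  ≡⟨ cong₂ (λ a c → a - + q * c) (∂residue≡bq v)
                                                                          (trans (∂-cong (ends G) backward≡χx v) (proj₂ solution v)) ⟩
        b v * + q - + q * b v                                       ≡⟨ cancel (b v) (+ q) ⟩
        + 0                                                         ∎
        where cancel : ∀ b q → b * q - q * b ≡ + 0
              cancel = solve-∀

module IntervalSums where

  open ListSums
  open Lifts using (liftEntry)
  open import Data.Nat
  open import Data.Nat.Properties
  open import Data.Integer as ℤ using (ℤ; +_; -[1+_]; ∣_∣)
  import Data.Integer.Properties as ℤP
  open import Data.Fin as Fin using (Fin; toℕ)
  open import Data.Bool using (Bool; true; false; if_then_else_)
  open import Data.List as List using ([]; _∷_; map; applyUpTo; upTo; allFin)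
  open import Data.Product using (_×_; _,_)
  open import Relation.Nullary using (Dec; ¬?)
  open import Relation.Nullary.Decidable using (_×-dec_)
  open import Relation.Binary.PropositionalEquality
  open import Function using (_∘_; id)

  rangeSum : ℕ → (ℕ → ℕ) → ℕ
  rangeSum zero    f = 0
  rangeSum (suc n) f = f 0 + rangeSum n (f ∘ suc)

  sumOver-applyUpTo : ∀ {A : Set} (g : ℕ → A) n F → sumOver (applyUpTo g n) F ≡ rangeSum n (F ∘ g)
  sumOver-applyUpTo g zero    F = refl
  sumOver-applyUpTo g (suc n) F = cong (_+_ (F (g 0))) (sumOver-applyUpTo (g ∘ suc) n F)

  sumOver-tabulate : ∀ {A : Set} n (g : Fin n → A) (F : A → ℕ) (H : ℕ → ℕ) → (∀ i → F (g i) ≡ H (toℕ i)) →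
    sumOver (List.tabulate g) F ≡ rangeSum n H
  sumOver-tabulate zero    g F H F∘g≗H = refl
  sumOver-tabulate (suc n) g F H F∘g≗H =
    cong₂ _+_ (F∘g≗H Fin.zero) (sumOver-tabulate n (g ∘ Fin.suc) F (H ∘ suc) (F∘g≗H ∘ Fin.suc))

  rangeSum-cong : ∀ n {f g : ℕ → ℕ} → (∀ i → i < n → f i ≡ g i) → rangeSum n f ≡ rangeSum n g
  rangeSum-cong zero    f≗g = refl
  rangeSum-cong (suc n) f≗g = cong₂ _+_ (f≗g 0 z<s) (rangeSum-cong n (λ i i<n → f≗g (suc i) (s<s i<n)))

  rangeSum-zero : ∀ n {f : ℕ → ℕ} → (∀ i → f i ≡ 0) → rangeSum n f ≡ 0
  rangeSum-zero zero    f≗0 = refl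
  rangeSum-zero (suc n) f≗0 = cong₂ _+_ (f≗0 0) (rangeSum-zero n (f≗0 ∘ suc))

  rangeSum-suc : ∀ n f → rangeSum (suc n) f ≡ rangeSum n f + f n
  rangeSum-suc zero    f = +-comm (f 0) 0
  rangeSum-suc (suc n) f = trans (cong (_+_ (f 0)) (rangeSum-suc n (f ∘ suc))) (sym (+-assoc (f 0) _ _))

  rangeSum-reverse : ∀ n f → rangeSum n (λ j → f (n ∸ suc j)) ≡ rangeSum n f
  rangeSum-reverse zero    f = refl
  rangeSum-reverse (suc n) f =
    trans (cong (_+_ (f n)) (rangeSum-reverse n f)) (trans (+-comm (f n) (rangeSum n f)) (sym (rangeSum-suc n f)))

  signEntry : Bool → ℤ → ℤ
  signEntry s y = if s then y else ℤ.- y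

  module _ (p : ℕ) where

    private
      q = suc p

    positiveBelow? : (x : ℤ) → Dec ((+ 0 ℤ.< x) × (x ℤ.< + q))
    positiveBelow? x = (+ 0 ℤP.<? x) ×-dec (x ℤP.<? + q)

    nonzeroBelow? : (x : ℤ) → Dec ((x ≢ + 0) × (∣ x ∣ < q))
    nonzeroBelow? x = ¬? (x ℤP.≟ + 0) ×-dec (∣ x ∣ <? q)

    nonzero? : (y : Fin q) → Dec (toℕ y ≢ 0)
    nonzero? y = ¬? (toℕ y ≟ 0)

    sumOver-intsBelow : ∀ (F : ℤ → ℕ) → sumOver (intsBelow q) F ≡ rangeSum q (F ∘ +_) + rangeSum q (F ∘ -[1+_])
    sumOver-intsBelow F = begin
      sumOver (map +_ (upTo q) List.++ map -[1+_] (upTo q)) F           ≡⟨ sumOver-++ (map +_ (upTo q)) _ F ⟩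
      sumOver (map +_ (upTo q)) F + sumOver (map -[1+_] (upTo q)) F     ≡⟨ cong₂ _+_ (trans (sumOver-map +_ (upTo q) F) (sumOver-applyUpTo id q (F ∘ +_)))
                                                                                    (trans (sumOver-map -[1+_] (upTo q) F) (sumOver-applyUpTo id q (F ∘ -[1+_]))) ⟩
      rangeSum q (F ∘ +_) + rangeSum q (F ∘ -[1+_])                      ∎
      where open ≡-Reasoning

    sumOver-positiveBelow : ∀ (F : ℤ → ℕ) → sumOver (intsBelow q) (λ y → 𝟙 (positiveBelow? y) * F y) ≡ rangeSum p (λ j → F (+ suc j))
    sumOver-positiveBelow F = begin
        sumOver (intsBelow q) (λ y → 𝟙 (positiveBelow? y) * F y)
      ≡⟨ sumOver-intsBelow (λ y → 𝟙 (positiveBelow? y) * F y) ⟩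
        𝟙 (positiveBelow? (+ 0)) * F (+ 0) + rangeSum p (λ j → 𝟙 (positiveBelow? (+ suc j)) * F (+ suc j))
          + rangeSum q (λ i → 𝟙 (positiveBelow? -[1+ i ]) * F -[1+ i ])
      ≡⟨ cong₂ _+_ (cong₂ _+_ (cong (_* F (+ 0)) (𝟙-no (positiveBelow? (+ 0)) λ { (ℤ.+<+ () , _) }))
                              (rangeSum-cong p (λ j j<p → trans (cong (_* F (+ suc j)) (𝟙-yes (positiveBelow? (+ suc j)) (ℤ.+<+ z<s , ℤ.+<+ (s<s j<p))))
                                                                (*-identityˡ (F (+ suc j))))))
                   (rangeSum-zero q (λ i → cong (_* F -[1+ i ]) (𝟙-no (positiveBelow? -[1+ i ]) λ { (() , _) }))) ⟩
        rangeSum p (λ j → F (+ suc j)) + 0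
      ≡⟨ +-identityʳ _ ⟩
        rangeSum p (λ j → F (+ suc j))
      ∎
      where open ≡-Reasoning

    sumOver-nonzeroBelow : ∀ (F : ℤ → ℕ) → sumOver (intsBelow q) (λ x → 𝟙 (nonzeroBelow? x) * F x)
                               ≡ rangeSum p (λ j → F (+ suc j)) + rangeSum p (λ j → F -[1+ j ])
    sumOver-nonzeroBelow F = trans (sumOver-intsBelow (λ x → 𝟙 (nonzeroBelow? x) * F x)) (cong₂ _+_ nonnegative negative)
      where
      open ≡-Reasoning
      nonnegative : rangeSum q (λ i → 𝟙 (nonzeroBelow? (+ i)) * F (+ i)) ≡ rangeSum p (λ j → F (+ suc j))
      nonnegative = cong₂ _+_ (cong (_* F (+ 0)) (𝟙-no (nonzeroBelow? (+ 0)) λ { (0≢0 , _) → 0≢0 refl }))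
        (rangeSum-cong p (λ j j<p → trans (cong (_* F (+ suc j)) (𝟙-yes (nonzeroBelow? (+ suc j)) ((λ ()) , s<s j<p)))
                                          (*-identityˡ (F (+ suc j)))))
      negative : rangeSum q (λ i → 𝟙 (nonzeroBelow? -[1+ i ]) * F -[1+ i ]) ≡ rangeSum p (λ j → F -[1+ j ])
      negative = begin
          rangeSum q (λ i → 𝟙 (nonzeroBelow? -[1+ i ]) * F -[1+ i ])
        ≡⟨ rangeSum-suc p _ ⟩
          rangeSum p (λ i → 𝟙 (nonzeroBelow? -[1+ i ]) * F -[1+ i ]) + 𝟙 (nonzeroBelow? -[1+ p ]) * F -[1+ p ]
        ≡⟨ cong₂ _+_ (rangeSum-cong p (λ j j<p → trans (cong (_* F -[1+ j ]) (𝟙-yes (nonzeroBelow? -[1+ j ]) ((λ ()) , s<s j<p)))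
                                                       (*-identityˡ (F -[1+ j ]))))
                     (cong (_* F -[1+ p ]) (𝟙-no (nonzeroBelow? -[1+ p ]) λ { (_ , q<q) → <-irrefl refl q<q })) ⟩
          rangeSum p (λ j → F -[1+ j ]) + 0
        ≡⟨ +-identityʳ _ ⟩
          rangeSum p (λ j → F -[1+ j ])
        ∎

    -- A nonzero integer in (−q, q) is a sign together with a value in (0, q).
    nonzeroBelow-split : ∀ (F : ℤ → ℕ) → sumOver (intsBelow q) (λ x → 𝟙 (nonzeroBelow? x) * F x)
      ≡ sumOver (true ∷ false ∷ []) (λ s → sumOver (intsBelow q) (λ y → 𝟙 (positiveBelow? y) * F (signEntry s y)))
    nonzeroBelow-split F = trans (sumOver-nonzeroBelow F)
      (sym (cong₂ _+_ (sumOver-positiveBelow F) (trans (+-identityʳ _) (sumOver-positiveBelow (F ∘ ℤ.-_)))))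

    -- Lifting a nonzero residue along either direction is a bijection onto (0, q).
    liftEntry-reindex : ∀ o (F : ℤ → ℕ) → sumOver (allFin q) (λ y → 𝟙 (nonzero? y) * F (liftEntry o y))
                              ≡ sumOver (intsBelow q) (λ x → 𝟙 (positiveBelow? x) * F x)
    liftEntry-reindex o F = begin
        sumOver (allFin q) (λ y → 𝟙 (nonzero? y) * F (liftEntry o y))
      ≡⟨ sumOver-tabulate q id _ (λ i → 𝟙 (¬? (i ≟ 0)) * F (liftValue o i)) (λ y → cong (λ z → 𝟙 (nonzero? y) * F z) (liftEntry≡liftValue o y)) ⟩
        0 + rangeSum p (λ j → 𝟙 (¬? (suc j ≟ 0)) * F (liftValue o (suc j)))
      ≡⟨ rangeSum-cong p (λ j _ → *-identityˡ (F (liftValue o (suc j)))) ⟩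
        rangeSum p (λ j → F (liftValue o (suc j)))
      ≡⟨ lifted o ⟩
        rangeSum p (λ j → F (+ suc j))
      ≡⟨ sym (sumOver-positiveBelow F) ⟩
        sumOver (intsBelow q) (λ x → 𝟙 (positiveBelow? x) * F x)
      ∎
      where
      open ≡-Reasoning
      liftValue : Bool → ℕ → ℤ
      liftValue true  i = + i
      liftValue false i = + q ℤ.- + i
      liftEntry≡liftValue : ∀ o (y : Fin q) → liftEntry o y ≡ liftValue o (toℕ y)
      liftEntry≡liftValue true  y = refl
      liftEntry≡liftValue false y = refl
      complement : ∀ j → j < p → + q ℤ.- + suc j ≡ + suc (p ∸ suc j)
      complement j j<p = trans (ℤP.m-n≡m⊖n q (suc j)) (trans (ℤP.⊖-≥ (s≤s (<⇒≤ j<p))) (cong +_ (+-∸-assoc 1 j<p)))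
      lifted : ∀ o → rangeSum p (λ j → F (liftValue o (suc j))) ≡ rangeSum p (λ j → F (+ suc j))
      lifted true  = refl
      lifted false = trans (rangeSum-cong p (λ j j<p → cong F (complement j j<p))) (rangeSum-reverse p (λ i → F (+ suc i)))

module FlowCounting where

  open ListSums
  open VectorSums
  open Boundary using (∂-cong)
  open IntegerFlows
  open Lifts
  open IntervalSums
  open import Data.Nat
  open import Data.Nat.Properties
  import Data.Integer as ℤ
  import Data.Integer.Properties as ℤP
  open import Data.Fin as Fin using (Fin; toℕ)
  open import Data.Bool using (true; false)
  open import Data.List as List using ([]; _∷_; allFin)
  open import Data.List.Relation.Unary.All as All using ()
  import Data.List.Relation.Unary.Any as Any
  import Data.List.Relation.Unary.AllPairs as AllPairs
  open import Data.Vec as Vec using (Vec; []; _∷_; lookup; zipWith)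
  open import Data.Vec.Properties using (lookup-zipWith; lookup-replicate)
  open import Data.Product using (Σ-syntax; _×_; _,_; proj₁; proj₂)
  open import Relation.Nullary using (Dec; yes; no; ¬_; ¬?)
  open import Relation.Nullary.Decidable using (_×-dec_)
  open import Relation.Binary.PropositionalEquality
  open import Function using (_∘_; _⇔_; mk⇔; Equivalence)

  𝟙-all : ∀ {A : Set} {U : A → Set} (U? : ∀ x → Dec (U x)) {k} (g : Vec A k) →
    𝟙 (all-dec (λ e → U? (lookup g e))) ≡ ∏ (𝟙 ∘ U?) g
  𝟙-all U? []      = 𝟙-yes (all-dec (λ e → U? (lookup [] e))) (λ ())
  𝟙-all U? (x ∷ g) = begin
    𝟙 (all-dec (λ e → U? (lookup (x ∷ g) e)))       ≡⟨ 𝟙-cong (all-dec (λ e → U? (lookup (x ∷ g) e))) (U? x ×-dec all-dec (λ e → U? (lookup g e)))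
                                                          (λ all → all Fin.zero , all ∘ Fin.suc)
                                                          (λ { (ux , _) Fin.zero → ux ; (_ , ug) (Fin.suc e) → ug e }) ⟩
    𝟙 (U? x ×-dec all-dec (λ e → U? (lookup g e)))  ≡⟨ 𝟙-× (U? x) (all-dec (λ e → U? (lookup g e))) ⟩
    𝟙 (U? x) * 𝟙 (all-dec (λ e → U? (lookup g e)))  ≡⟨ cong (𝟙 (U? x) *_) (𝟙-all U? g) ⟩
    𝟙 (U? x) * ∏ (𝟙 ∘ U?) g                         ∎
    where open ≡-Reasoning

  𝟙-flow×all : ∀ {A : Set} {F : Set} {U V : A → Set} (F? : Dec F) (U? : ∀ x → Dec (U x)) (V? : ∀ x → Dec (V x))
    {k} (g : Vec A k) →
    𝟙 (F? ×-dec all-dec (λ e → U? (lookup g e)) ×-dec all-dec (λ e → V? (lookup g e)))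
    ≡ ∏ (λ x → 𝟙 (U? x ×-dec V? x)) g * 𝟙 F?
  𝟙-flow×all F? U? V? g = begin
      𝟙 (F? ×-dec all-dec (λ e → U? (lookup g e)) ×-dec all-dec (λ e → V? (lookup g e)))
    ≡⟨ 𝟙-× F? (all-dec (λ e → U? (lookup g e)) ×-dec all-dec (λ e → V? (lookup g e))) ⟩
      𝟙 F? * 𝟙 (all-dec (λ e → U? (lookup g e)) ×-dec all-dec (λ e → V? (lookup g e)))
    ≡⟨ cong (𝟙 F? *_) (𝟙-cong (all-dec (λ e → U? (lookup g e)) ×-dec all-dec (λ e → V? (lookup g e))) (all-dec (λ e → U? (lookup g e) ×-dec V? (lookup g e)))
         (λ { (us , vs) e → us e , vs e }) (λ uvs → (λ e → proj₁ (uvs e)) , (λ e → proj₂ (uvs e)))) ⟩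
      𝟙 F? * 𝟙 (all-dec (λ e → U? (lookup g e) ×-dec V? (lookup g e)))
    ≡⟨ cong (𝟙 F? *_) (𝟙-all (λ x → U? x ×-dec V? x) g) ⟩
      𝟙 F? * ∏ (λ x → 𝟙 (U? x ×-dec V? x)) g
    ≡⟨ *-comm (𝟙 F?) _ ⟩
      ∏ (λ x → 𝟙 (U? x ×-dec V? x)) g * 𝟙 F?
    ∎
    where open ≡-Reasoning

  module _ (G : Graph) (p : ℕ) where

    private
      q = suc p
      L = intsBelow q
      orientations = allOrientations G
      residueVectors = vecs (allFin q) (m G)
      φᵨ : Orientation G → ℕ
      φᵨ ρ = φ[_] {G} ρ q
      liftIndicator : Orientation G → Vec (Fin q) (m G) → ℕ
      liftIndicator σ f = ∏ (𝟙 ∘ nonzero? p) f * 𝟙 (ℤ-flow? G σ (lift G p σ f))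
      positiveFlowBelow? : ∀ ρ h → Dec (PosIntFlowBelow G ρ q h)
      positiveFlowBelow? ρ h = ℤ-flow? G ρ h ×-dec all-dec (λ e → ℤ.+ 0 ℤP.<? lookup h e) ×-dec all-dec (λ e → lookup h e ℤP.<? ℤ.+ q)

    φℤ≡sumOver : φℤ G q ≡ sumOver (vecs L (m G)) (λ g → ∏ (𝟙 ∘ nonzeroBelow? p) g * 𝟙 (ℤ-flow? G (ε G) g))
    φℤ≡sumOver = trans (count≡sumOver𝟙 (λ g → ℤ-flow? G (ε G) g ×-dec all-dec (λ e → ¬? (lookup g e ℤP.≟ ℤ.+ 0))
                                                      ×-dec all-dec (λ e → ℤ.∣ lookup g e ∣ <? q)) (vecs L (m G)))
      (sumOver-cong (vecs L (m G)) (λ g → 𝟙-flow×all (ℤ-flow? G (ε G) g) (λ x → ¬? (x ℤP.≟ ℤ.+ 0)) (λ x → ℤ.∣ x ∣ <? q) g))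

    φ[ρ]≡sumOver : ∀ ρ → φᵨ ρ ≡ sumOver (vecs L (m G)) (λ h → ∏ (𝟙 ∘ positiveBelow? p) h * 𝟙 (ℤ-flow? G ρ h))
    φ[ρ]≡sumOver ρ = trans (count≡sumOver𝟙 (positiveFlowBelow? ρ) (vecs L (m G)))
      (sumOver-cong (vecs L (m G)) (λ h → 𝟙-flow×all (ℤ-flow? G ρ h) (λ x → ℤ.+ 0 ℤP.<? x) (λ x → x ℤP.<? ℤ.+ q) h))

    signed-signEntry : ∀ ρ h e → signed G (ε G) (zipWith signEntry ρ h) e ≡ signed G ρ h e
    signed-signEntry ρ h e rewrite lookup-replicate e true | lookup-zipWith signEntry e ρ h = refl

    φℤ≡∑φ[ρ] : φℤ G q ≡ sumOver orientations (λ ρ → φᵨ ρ)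
    φℤ≡∑φ[ρ] = begin
        φℤ G q
      ≡⟨ φℤ≡sumOver ⟩
        sumOver (vecs L (m G)) (λ g → ∏ (𝟙 ∘ nonzeroBelow? p) g * 𝟙 (ℤ-flow? G (ε G) g))
      ≡⟨ sumOver-vecs-split L L (𝟙 ∘ nonzeroBelow? p) (𝟙 ∘ positiveBelow? p) signEntry (true ∷ false ∷ [])
                            (nonzeroBelow-split p) (m G) (λ g → 𝟙 (ℤ-flow? G (ε G) g)) ⟩
        sumOver orientations (λ ρ → sumOver (vecs L (m G)) (λ h → ∏ (𝟙 ∘ positiveBelow? p) h * 𝟙 (ℤ-flow? G (ε G) (zipWith signEntry ρ h))))
      ≡⟨ sumOver-cong orientations (λ ρ → sumOver-cong (vecs L (m G)) (λ h → cong (∏ (𝟙 ∘ positiveBelow? p) h *_)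
           (𝟙-cong (ℤ-flow? G (ε G) (zipWith signEntry ρ h)) (ℤ-flow? G ρ h)
             (λ flow → circulation⇒isIntFlow G {ρ} {h} (λ v →
                trans (sym (∂-cong (ends G) (signed-signEntry ρ h) v)) (isIntFlow⇒circulation G {ε G} {zipWith signEntry ρ h} flow v)))
             (λ flow → circulation⇒isIntFlow G {ε G} {zipWith signEntry ρ h} (λ v →
                trans (∂-cong (ends G) (signed-signEntry ρ h) v) (isIntFlow⇒circulation G {ρ} {h} flow v)))))) ⟩
        sumOver orientations (λ ρ → sumOver (vecs L (m G)) (λ h → ∏ (𝟙 ∘ positiveBelow? p) h * 𝟙 (ℤ-flow? G ρ h)))
      ≡⟨ sumOver-cong orientations (λ ρ → sym (φ[ρ]≡sumOver ρ)) ⟩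
        sumOver orientations (λ ρ → φᵨ ρ)
      ∎
      where open ≡-Reasoning

    φ[ρ]≡0 : ∀ ρ → ¬ TotallyCyclic G ρ → φᵨ ρ ≡ 0
    φ[ρ]≡0 ρ ¬tc = trans (count≡sumOver𝟙 (positiveFlowBelow? ρ) (vecs L (m G))) (sumOver-zero (vecs L (m G)) (λ h →
      𝟙-no (positiveFlowBelow? ρ h) (λ { (flow , positive , _) → ¬tc (positiveFlow⇒totallyCyclic G {ρ} {h} flow positive) })))

    𝟙tc*φ[ρ]≡φ[ρ] : ∀ ρ (tc? : Dec (TotallyCyclic G ρ)) → 𝟙 tc? * φᵨ ρ ≡ φᵨ ρ
    𝟙tc*φ[ρ]≡φ[ρ] ρ (yes _)  = +-identityʳ (φᵨ ρ)
    𝟙tc*φ[ρ]≡φ[ρ] ρ (no ¬tc) = sym (φ[ρ]≡0 ρ ¬tc)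

    φ[ρ]≡∑liftIndicator : ∀ ρ → φᵨ ρ ≡ sumOver residueVectors (liftIndicator ρ)
    φ[ρ]≡∑liftIndicator ρ = trans (φ[ρ]≡sumOver ρ)
      (sym (sumOver-vecs-reindex L (allFin q) (𝟙 ∘ positiveBelow? p) (𝟙 ∘ nonzero? p) liftEntry (liftEntry-reindex p)
                                 ρ (λ h → 𝟙 (ℤ-flow? G ρ h))))

    liftFlow⇔ : ∀ {σ ρ} f → EulerEquiv G σ ρ → IsIntFlow G σ (lift G p σ f) ⇔ IsIntFlow G ρ (lift G p ρ f)
    liftFlow⇔ {σ} {ρ} f σ~ρ = mk⇔
      (λ flow → circulation⇒isIntFlow G {ρ} {lift G p ρ f} (λ v →
         trans (sym (∂-lift-eulerEquiv G p {σ} {ρ} f σ~ρ v)) (isIntFlow⇒circulation G {σ} {lift G p σ f} flow v)))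
      (λ flow → circulation⇒isIntFlow G {σ} {lift G p σ f} (λ v →
         trans (∂-lift-eulerEquiv G p {σ} {ρ} f σ~ρ v) (isIntFlow⇒circulation G {ρ} {lift G p ρ f} flow v)))

    φ[]-eulerInvariant : ∀ {σ ρ} → EulerEquiv G σ ρ → φᵨ σ ≡ φᵨ ρ
    φ[]-eulerInvariant {σ} {ρ} σ~ρ = begin
      φᵨ σ                                                                                   ≡⟨ φ[ρ]≡∑liftIndicator σ ⟩
      sumOver residueVectors (liftIndicator σ)     ≡⟨ sumOver-cong residueVectors (λ f →
        cong (∏ (𝟙 ∘ nonzero? p) f *_) (𝟙-cong (ℤ-flow? G σ (lift G p σ f)) (ℤ-flow? G ρ (lift G p ρ f))
          (Equivalence.to (liftFlow⇔ {σ} {ρ} f σ~ρ)) (Equivalence.from (liftFlow⇔ {σ} {ρ} f σ~ρ)))) ⟩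
      sumOver residueVectors (liftIndicator ρ)     ≡⟨ sym (φ[ρ]≡∑liftIndicator ρ) ⟩
      φᵨ ρ                                                                                   ∎
      where open ≡-Reasoning

    -- For totally cyclic ρ exactly one representative is equivalent to ρ, and it has the same φ.
    𝟙tc*φ≡∑representatives : ∀ {R} → IsRepresentatives G R → ∀ ρ (tc? : Dec (TotallyCyclic G ρ)) →
      𝟙 tc? * φᵨ ρ ≡ sumOver R (λ r → 𝟙 (tc? ×-dec EulerEquiv? G ρ r) * φᵨ r)
    𝟙tc*φ≡∑representatives {R} (_ , inequivalent , cover) ρ (yes tc) =
      trans (+-identityʳ (φᵨ ρ)) (sym (sumOver-𝟙-unique (λ r → yes tc ×-dec EulerEquiv? G ρ r) φᵨ R
        (Any.map (tc ,_) (cover ρ tc))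
        (AllPairs.map (λ {r} {r′} r≁r′ ((_ , ρ~r) , (_ , ρ~r′)) → r≁r′ (eulerEquiv-euclidean G {ρ} {r} {r′} ρ~r ρ~r′)) inequivalent)
        (λ r (_ , ρ~r) → sym (φ[]-eulerInvariant {ρ} {r} ρ~r))))
    𝟙tc*φ≡∑representatives {R} _ ρ (no ¬tc) =
      sym (sumOver-𝟙-none (λ r → no ¬tc ×-dec EulerEquiv? G ρ r) φᵨ R (All.tabulate (λ _ (tc , _) → ¬tc tc)))

    φℤ≡∑classSize*φ : ∀ R → IsRepresentatives G R → φℤ G q ≡ sumOver R (λ r → classSize G r * φᵨ r)
    φℤ≡∑classSize*φ R representatives = begin
        φℤ G q
      ≡⟨ φℤ≡∑φ[ρ] ⟩
        sumOver orientations φᵨ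
      ≡⟨ sumOver-cong orientations (λ ρ → sym (𝟙tc*φ[ρ]≡φ[ρ] ρ (TotallyCyclic? G ρ))) ⟩
        sumOver orientations (λ ρ → 𝟙 (TotallyCyclic? G ρ) * φᵨ ρ)
      ≡⟨ sumOver-cong orientations (λ ρ → 𝟙tc*φ≡∑representatives representatives ρ (TotallyCyclic? G ρ)) ⟩
        sumOver orientations (λ ρ → sumOver R (λ r → 𝟙 (inClass? ρ r) * φᵨ r))
      ≡⟨ sumOver-swap orientations R (λ ρ r → 𝟙 (inClass? ρ r) * φᵨ r) ⟩
        sumOver R (λ r → sumOver orientations (λ ρ → 𝟙 (inClass? ρ r) * φᵨ r))
      ≡⟨ sumOver-cong R (λ r → trans (sym (*-distribʳ-sumOver (φᵨ r) orientations (λ ρ → 𝟙 (inClass? ρ r))))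
                                     (cong (_* φᵨ r) (sym (count≡sumOver𝟙 (λ ρ → inClass? ρ r) orientations)))) ⟩
        sumOver R (λ r → classSize G r * φᵨ r)
      ∎
      where
      open ≡-Reasoning
      inClass? : ∀ ρ r → Dec (TotallyCyclic G ρ × EulerEquiv G ρ r)
      inClass? ρ r = TotallyCyclic? G ρ ×-dec EulerEquiv? G ρ r

    liftClass : ∀ {f} → NZZqFlow G q f → Σ[ ρ₀ ∈ Orientation G ] TotallyCyclic G ρ₀ × IsIntFlow G ρ₀ (lift G p ρ₀ f)
    liftClass {f} (zq , nonzero) = ρ₀ , positiveFlow⇒totallyCyclic G {ρ₀} {lift G p ρ₀ f} flow (lift-positive G p nonzero ρ₀) , flow
      where
      ρ₀ = proj₁ (isZqFlow⇒liftCirculation G p zq)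
      flow : IsIntFlow G ρ₀ (lift G p ρ₀ f)
      flow = circulation⇒isIntFlow G {ρ₀} {lift G p ρ₀ f} (proj₂ (isZqFlow⇒liftCirculation G p zq))

    liftFlow⇔eulerEquiv : ∀ {ρ₀ σ f} → IsIntFlow G ρ₀ (lift G p ρ₀ f) → IsIntFlow G σ (lift G p σ f) ⇔ EulerEquiv G σ ρ₀
    liftFlow⇔eulerEquiv {ρ₀} {σ} {f} flow₀ = mk⇔
      (λ flow → liftCirculations⇒eulerEquiv G p {σ} {ρ₀} {f}
                  (isIntFlow⇒circulation G {σ} {lift G p σ f} flow) (isIntFlow⇒circulation G {ρ₀} {lift G p ρ₀ f} flow₀))
      (λ σ~ρ₀ → Equivalence.from (liftFlow⇔ {σ} {ρ₀} f σ~ρ₀) flow₀)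

    𝟙-inClass≡𝟙tc*liftIndicator : ∀ {ρ₀ f} → (∀ e → toℕ (lookup f e) ≢ 0) → IsIntFlow G ρ₀ (lift G p ρ₀ f) → ∀ σ →
      𝟙 (TotallyCyclic? G σ ×-dec EulerEquiv? G σ ρ₀) ≡ 𝟙 (TotallyCyclic? G σ) * liftIndicator σ f
    𝟙-inClass≡𝟙tc*liftIndicator {ρ₀} {f} nonzero flow₀ σ = begin
        𝟙 (TotallyCyclic? G σ ×-dec EulerEquiv? G σ ρ₀)
      ≡⟨ 𝟙-cong (TotallyCyclic? G σ ×-dec EulerEquiv? G σ ρ₀) (TotallyCyclic? G σ ×-dec ℤ-flow? G σ (lift G p σ f))
           (λ (tc , σ~ρ₀) → tc , Equivalence.from (liftFlow⇔eulerEquiv {ρ₀} {σ} {f} flow₀) σ~ρ₀)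
           (λ (tc , flow) → tc , Equivalence.to (liftFlow⇔eulerEquiv {ρ₀} {σ} {f} flow₀) flow) ⟩
        𝟙 (TotallyCyclic? G σ ×-dec ℤ-flow? G σ (lift G p σ f))
      ≡⟨ 𝟙-× (TotallyCyclic? G σ) (ℤ-flow? G σ (lift G p σ f)) ⟩
        𝟙 (TotallyCyclic? G σ) * 𝟙 (ℤ-flow? G σ (lift G p σ f))
      ≡⟨ cong (𝟙 (TotallyCyclic? G σ) *_) (trans (sym (*-identityˡ (𝟙 (ℤ-flow? G σ (lift G p σ f)))))
                                                (cong (_* 𝟙 (ℤ-flow? G σ (lift G p σ f))) (sym ∏nonzero≡1))) ⟩
        𝟙 (TotallyCyclic? G σ) * liftIndicator σ f
      ∎
      where
      open ≡-Reasoning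
      ∏nonzero≡1 : ∏ (𝟙 ∘ nonzero? p) f ≡ 1
      ∏nonzero≡1 = trans (sym (𝟙-all (nonzero? p) f)) (𝟙-yes (all-dec (λ e → nonzero? p (lookup f e))) nonzero)

    liftIndicator≡0 : ∀ {f} → ¬ NZZqFlow G q f → ∀ σ → liftIndicator σ f ≡ 0
    liftIndicator≡0 {f} ¬zq σ = noLift (ℤ-flow? G σ (lift G p σ f))
      where
      noLift : (flow? : Dec (IsIntFlow G σ (lift G p σ f))) → ∏ (𝟙 ∘ nonzero? p) f * 𝟙 flow? ≡ 0
      noLift (no _)     = *-zeroʳ (∏ (𝟙 ∘ nonzero? p) f)
      noLift (yes flow) = trans (*-identityʳ (∏ (𝟙 ∘ nonzero? p) f)) (trans (sym (𝟙-all (nonzero? p) f))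
        (𝟙-no (all-dec (λ e → nonzero? p (lookup f e)))
          (λ nonzero → ¬zq (liftCirculation⇒isZqFlow G p {σ} {f} (isIntFlow⇒circulation G {σ} {lift G p σ f} flow) , nonzero))))

    -- Every nowhere-zero ℤ_q-flow lifts to a positive flow along exactly one
    -- class of totally cyclic orientations.
    c*𝟙≡∑liftIndicator : ∀ c → (∀ ρ → TotallyCyclic G ρ → classSize G ρ ≡ c) → ∀ f (zq? : Dec (NZZqFlow G q f)) →
      c * 𝟙 zq? ≡ sumOver orientations (λ σ → 𝟙 (TotallyCyclic? G σ) * liftIndicator σ f)
    c*𝟙≡∑liftIndicator c constant f (yes (zq , nonzero)) = begin
        c * 1
      ≡⟨ *-identityʳ c ⟩
        c
      ≡⟨ sym (constant ρ₀ tc₀) ⟩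
        classSize G ρ₀
      ≡⟨ count≡sumOver𝟙 (λ σ → TotallyCyclic? G σ ×-dec EulerEquiv? G σ ρ₀) orientations ⟩
        sumOver orientations (λ σ → 𝟙 (TotallyCyclic? G σ ×-dec EulerEquiv? G σ ρ₀))
      ≡⟨ sumOver-cong orientations (𝟙-inClass≡𝟙tc*liftIndicator {ρ₀} {f} nonzero flow₀) ⟩
        sumOver orientations (λ σ → 𝟙 (TotallyCyclic? G σ) * liftIndicator σ f)
      ∎
      where
      open ≡-Reasoning
      lifted = liftClass (zq , nonzero)
      ρ₀ = proj₁ lifted
      tc₀ = proj₁ (proj₂ lifted)
      flow₀ = proj₂ (proj₂ lifted)
    c*𝟙≡∑liftIndicator c constant f (no ¬zq) = trans (*-zeroʳ c) (sym (sumOver-zero orientations (λ σ →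
      trans (cong (𝟙 (TotallyCyclic? G σ) *_) (liftIndicator≡0 {f} ¬zq σ)) (*-zeroʳ (𝟙 (TotallyCyclic? G σ))))))

    φℤ≡c*φ : ∀ c → (∀ ρ → TotallyCyclic G ρ → classSize G ρ ≡ c) → φℤ G q ≡ c * φ G q
    φℤ≡c*φ c constant = sym (begin
        c * φ G q
      ≡⟨ cong (c *_) (count≡sumOver𝟙 zq? residueVectors) ⟩
        c * sumOver residueVectors (λ f → 𝟙 (zq? f))
      ≡⟨ *-distribˡ-sumOver c residueVectors (λ f → 𝟙 (zq? f)) ⟩
        sumOver residueVectors (λ f → c * 𝟙 (zq? f))
      ≡⟨ sumOver-cong residueVectors (λ f → c*𝟙≡∑liftIndicator c constant f (zq? f)) ⟩
        sumOver residueVectors (λ f → sumOver orientations (λ σ → 𝟙 (TotallyCyclic? G σ) * liftIndicator σ f))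
      ≡⟨ sumOver-swap residueVectors orientations (λ f σ → 𝟙 (TotallyCyclic? G σ) * liftIndicator σ f) ⟩
        sumOver orientations (λ σ → sumOver residueVectors (λ f → 𝟙 (TotallyCyclic? G σ) * liftIndicator σ f))
      ≡⟨ sumOver-cong orientations (λ σ → trans (sym (*-distribˡ-sumOver (𝟙 (TotallyCyclic? G σ)) residueVectors (liftIndicator σ)))
                                                (cong (𝟙 (TotallyCyclic? G σ) *_) (sym (φ[ρ]≡∑liftIndicator σ)))) ⟩
        sumOver orientations (λ σ → 𝟙 (TotallyCyclic? G σ) * φᵨ σ)
      ≡⟨ sumOver-cong orientations (λ σ → 𝟙tc*φ[ρ]≡φ[ρ] σ (TotallyCyclic? G σ)) ⟩
        sumOver orientations φᵨ
      ≡⟨ sym φℤ≡∑φ[ρ] ⟩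
        φℤ G q
      ∎)
      where
      open ≡-Reasoning
      zq? : ∀ f → Dec (NZZqFlow G q f)
      zq? f = Zq-flow? G q (ε G) f ×-dec all-dec (λ e → ¬? (toℕ (lookup f e) ≟ 0))

open FlowCounting
open import Data.Nat using (ℕ; suc; _≤_; _*_)
open import Data.List using (List)
open import Data.Product using (_×_; _,_)
open import Relation.Binary.PropositionalEquality using (_≡_)

corollary4p11 : (G : Graph) →
    ((R : List (Orientation G)) → IsRepresentatives G R →
      (q : ℕ) → 1 ≤ q → φℤ G q ≡ sumOver R (λ r → classSize G r * φ[_] {G} r q))
    ×
    ((c : ℕ) → ((ρ : Orientation G) → TotallyCyclic G ρ → classSize G ρ ≡ c) →
      (q : ℕ) → 1 ≤ q → φℤ G q ≡ c * φ G q)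
corollary4p11 G =
  (λ { R representatives (suc p) _ → φℤ≡∑classSize*φ G p R representatives }) ,
  (λ { c constant (suc p) _ → φℤ≡c*φ G p c constant })
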